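{- Let $G$ be a simple graph and let $e=v_iv_j$ be a non-pendent edge of $G$ (neither $v_i$ nor $v_j$ has degree $1$). If either (i) $\max\left\{\dfrac{d_i}{d_{\min}^{(i)}},\dfrac{d_j}{d_{\min}^{(j)}}\right\}\le 1$, or (ii) $\max\left\{\dfrac{d_i}{d_j},\dfrac{d_j}{d_i}\right\}\le \min\left\{\dfrac{d_i-\frac12}{d_{\max}^{(i)}},\dfrac{d_j-\frac12}{d_{\max}^{(j)}}\right\}$, then $GA(G)>GA(G-e)$.
   Context: $d_k$ denotes the degree of vertex $v_k$ in $G$, and $N(v)$ the neighbourhood of $v$. For the edge $v_iv_j$: $d_{\min}^{(j)}=\min\{d_k : v_k\in N(v_j)\setminus\{v_i\}\}$, $d_{\max}^{(j)}=\max\{d_k : v_k\in N(v_j)\setminus\{v_i\}\}$, and symmetrically $d_{\min}^{(i)}=\min\{d_k : v_k\in N(v_i)\setminus\{v_j\}\}$, $d_{\max}^{(i)}=\max\{d_k : v_k\in N(v_i)\setminus\{v_j\}\}$ (degrees in $G$). The first geometric-arithmetic index is $GA(H)=\sum_{uv\in E(H)}\frac{2\sqrt{d_H(u)d_H(v)}}{d_H(u)+d_H(v)}$, with degrees taken in $H$; $G-e$ is $G$ with edge $e$ deleted. -}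

module Defs where

open import Data.Bool using (Bool; true; false; if_then_else_; _∧_; _∨_)
open import Data.Nat as ℕ using (ℕ; _<?_)
open import Data.Fin using (Fin; toℕ; _≟_)
open import Data.List using (List; []; _∷_; map; foldr; concatMap; allFin)
open import Data.Product using (_×_; _,_)
open import Data.Integer using (+_)
open import Data.Rational as ℚ using (ℚ; 0ℚ; 1ℚ; _+_; _*_; _-_; _≤_; _<_; ½)
open import Relation.Nullary using (yes; no)
open import Relation.Nullary.Decidable using (⌊_⌋)
open import Relation.Binary.PropositionalEquality using (_≡_; _≢_)

-- A graph on vertex set Fin n given by its adjacency function.
-- Simplicity (symmetry, irreflexivity) is imposed in the theorem.
Adj : ℕ → Set
Adj n = Fin n → Fin n → Bool

symmetric : ∀ {n} → Adj n → Set
symmetric {n} A = (a b : Fin n) → A a b ≡ A b a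

loopless : ∀ {n} → Adj n → Set
loopless {n} A = (a : Fin n) → A a a ≡ false

deg : ∀ {n} → Adj n → Fin n → ℕ
deg {n} A v = foldr ℕ._+_ 0 (map (λ u → if A v u then 1 else 0) (allFin n))

edges : ∀ {n} → Adj n → List (Fin n × Fin n)
edges {n} A = concatMap (λ a → concatMap (λ b →
  if A a b ∧ ⌊ toℕ a <? toℕ b ⌋ then (a , b) ∷ [] else []) (allFin n)) (allFin n)

deleteEdge : ∀ {n} → Adj n → Fin n → Fin n → Adj n
deleteEdge A i j a b =
  if (⌊ a ≟ i ⌋ ∧ ⌊ b ≟ j ⌋) ∨ (⌊ a ≟ j ⌋ ∧ ⌊ b ≟ i ⌋) then false else A a b

otherNbrDegs : ∀ {n} → Adj n → Fin n → Fin n → List ℕ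
otherNbrDegs {n} A i j = concatMap (λ u →
  if A i u ∧ (if ⌊ u ≟ j ⌋ then false else true) then deg A u ∷ [] else []) (allFin n)

minL : List ℕ → ℕ
minL []       = 0
minL (x ∷ xs) = foldr ℕ._⊓_ x xs

maxL : List ℕ → ℕ
maxL = foldr ℕ._⊔_ 0

-- d_min^{(i)} for edge v_i v_j  (min over N(v_i) \ {v_j}; only used when nonempty)
dmin : ∀ {n} → Adj n → Fin n → Fin n → ℕ
dmin A i j = minL (otherNbrDegs A i j)

dmax : ∀ {n} → Adj n → Fin n → Fin n → ℕ
dmax A i j = maxL (otherNbrDegs A i j)

fromℕ : ℕ → ℚ
fromℕ k = + k ℚ./ 1

-- division; the value at denominator 0 is a junk 0 (never used under the hypotheses)
_÷_ : ℚ → ℚ → ℚ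
p ÷ q with q ℚ.≟ 0ℚ
... | yes _  = 0ℚ
... | no q≢0 = ℚ._÷_ p q {{ℚ.≢-nonZero q≢0}}

sumℚ : List ℚ → ℚ
sumℚ = foldr _+_ 0ℚ

-- GA(H) is a sum of irrational numbers 2√(d_u d_v)/(d_u+d_v).  Since there are no
-- reals in the library, each √(d_u d_v) is represented by rational lower/upper bounds.
-- q is a valid family of lower (resp. upper) bounds for √(d_u d_v) on edges of H:
LowerSqrts : ∀ {n} → Adj n → (Fin n → Fin n → ℚ) → Set
LowerSqrts {n} A q = (a b : Fin n) → A a b ≡ true →
  (0ℚ ≤ q a b) × (q a b * q a b ≤ fromℕ (deg A a ℕ.* deg A b))

UpperSqrts : ∀ {n} → Adj n → (Fin n → Fin n → ℚ) → Set
UpperSqrts {n} A q = (a b : Fin n) → A a b ≡ true →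
  (0ℚ ≤ q a b) × (fromℕ (deg A a ℕ.* deg A b) ≤ q a b * q a b)

GAwith : ∀ {n} → Adj n → (Fin n → Fin n → ℚ) → ℚ
GAwith A q = sumℚ (map (λ { (a , b) →
  (fromℕ 2 * q a b) ÷ fromℕ (deg A a ℕ.+ deg A b) }) (edges A))

-- GA(G) > GA(H): strict inequality of the real numbers, witnessed (as for Bishop
-- reals) by rational bounds separating them: a lower bound for GA(G) exceeding an
-- upper bound for GA(H).
GA> : ∀ {n} → Adj n → Adj n → Set
GA> {n} G H = Data.Product.∃₂ λ (qL qU : Fin n → Fin n → ℚ) →
  LowerSqrts G qL × UpperSqrts H qU × (GAwith H qU < GAwith G qL)
  where import Data.Product

-- Write a = d_i and b = d_j. Deleting e lowers the degrees of i and j by one, so GA(G) − GA(G − e) is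
-- the term T = 2√(ab)/(a+b) of e minus the changes of the terms 2√(d_v d_u)/(d_v + d_u) of the other
-- edges vu at v ∈ {i, j}. The term of such an edge increases only if d_u < d_v (roughly), which (i)
-- excludes; under (ii) each of the a − 1 edges at i gains at most (2a − 1)/(4a(a − 1)) · T, so together
-- at most T/2 − T/(4a), and symmetrically at j.
-- GA being irrational, the inequality is witnessed by rational bounds: √(d_u d_v) is approximated from
-- below in G to within ε = 1/(2n⁴ + 1), and bounded from above in G − e by the same value plus ε,
-- multiplied at each endpoint v of e by shrink d_v ≥ √(1 − 1/d_v). The accumulated rounding error n²ε
-- stays below the margin T/(4a) + T/(4b) ≥ 1/(2n²) that is left in either case.

module Submission where

open import Level using (0ℓ)
open import Algebra.Bundles using (CommutativeRing)
open import Data.Bool using (Bool; true; false; if_then_else_; _∧_; _∨_)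
import Data.Bool.Properties as Bool
open import Data.Fin as Fin using (Fin; zero; suc; toℕ; _≟_)
import Data.Fin.Properties as Fin
import Data.Integer as ℤ
import Data.Integer.Properties as ℤ
open import Data.List as List using (List; []; _∷_; _++_; map; foldr; concatMap; allFin; tabulate)
import Data.List.Properties as List
open import Data.List.Membership.Propositional using (_∈_)
open import Data.List.Membership.Propositional.Properties using (∈-concatMap⁺; ∈-allFin)
open import Data.List.Relation.Unary.All as All using (All; []; _∷_)
import Data.List.Relation.Unary.All.Properties as All
open import Data.List.Relation.Unary.Any as Any using (Any; here; there)
open import Data.Nat as ℕ using (ℕ; zero; suc)
import Data.Nat.Properties as ℕ
open import Data.Product using (_×_; _,_; proj₁; proj₂)
open import Data.Rational as ℚ using (ℚ; 0ℚ; 1ℚ; _+_; _*_; _-_; -_; _≤_; _<_; 1/_; ½; _⊔_; _⊓_)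
open import Data.Rational.Properties hiding (_≟_)
import Data.Rational.Literals as Literals
open import Algebra.Properties.Semiring.Sum (CommutativeRing.semiring +-*-commutativeRing)
  using (sum; sum-syntax; ∑-distrib-+; ∑-comm; *-distribʳ-sum; sum-cong-≗)
open import Data.Sum using (_⊎_; inj₁; inj₂)
open import Function using (_∘_; id)
open import Relation.Binary.Definitions using (tri<; tri≈; tri>)
open import Relation.Binary.PropositionalEquality
open import Relation.Nullary using (yes; no; ¬_)
open import Relation.Nullary.Decidable using (Dec; ⌊_⌋; dec⇒maybe; dec-true; dec-false; isYes≗does; ⌊⌋-map′)
open import Relation.Nullary.Negation using (contradiction)
import Tactic.RingSolver.Core.AlmostCommutativeRing as ACR
open import Tactic.RingSolver using (solve-∀)
open import Defs

private variable n : ℕ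

-- Rational arithmetic

-- Natural-number arguments under fromℕ, and rational ones under arithmetic operations, are passed
-- explicitly throughout: unification would otherwise unfold fromℕ into its gcd normalisation.

ℚ-ring : ACR.AlmostCommutativeRing 0ℓ 0ℓ
ℚ-ring = ACR.fromCommutativeRing +-*-commutativeRing (λ x → dec⇒maybe (0ℚ ℚ.≟ x))

fromℕ≡fromℤ : ∀ m → fromℕ m ≡ Literals.fromℤ (ℤ.+ m)
fromℕ≡fromℤ m = ↥p/↧p≡p (Literals.fromℤ (ℤ.+ m))

fromℕ-+ : ∀ m n → fromℕ (m ℕ.+ n) ≡ fromℕ m + fromℕ n
fromℕ-+ m n = begin
  fromℕ (m ℕ.+ n)                       ≡⟨ /-cong {p₁ = ℤ.+ (m ℕ.+ n)} {q₁ = 1} {p₂ = ℤ.+ m ℤ.* ℤ.+ 1 ℤ.+ ℤ.+ n ℤ.* ℤ.+ 1} {q₂ = 1}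
                                             (trans (ℤ.pos-+ m n) (sym (cong₂ ℤ._+_ (ℤ.*-identityʳ (ℤ.+ m)) (ℤ.*-identityʳ (ℤ.+ n))))) refl ⟩
  Literals.fromℤ (ℤ.+ m) + Literals.fromℤ (ℤ.+ n) ≡⟨ sym (cong₂ _+_ (fromℕ≡fromℤ m) (fromℕ≡fromℤ n)) ⟩
  fromℕ m + fromℕ n                     ∎
  where open ≡-Reasoning

fromℕ-* : ∀ m n → fromℕ (m ℕ.* n) ≡ fromℕ m * fromℕ n
fromℕ-* m n = trans (/-cong {p₁ = ℤ.+ (m ℕ.* n)} {q₁ = 1} {p₂ = ℤ.+ m ℤ.* ℤ.+ n} {q₂ = 1} (ℤ.pos-* m n) refl)
                    (sym (cong₂ _*_ (fromℕ≡fromℤ m) (fromℕ≡fromℤ n)))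

fromℕ-suc : ∀ m → fromℕ (suc m) ≡ fromℕ m + 1ℚ
fromℕ-suc m = trans (fromℕ-+ 1 m) (+-comm 1ℚ (fromℕ m))

fromℕ-mono-≤ : ∀ {m n} → m ℕ.≤ n → fromℕ m ≤ fromℕ n
fromℕ-mono-≤ {m} {n} m≤n = subst₂ _≤_ (sym (fromℕ≡fromℤ m)) (sym (fromℕ≡fromℤ n))
  (ℚ.*≤* (subst₂ ℤ._≤_ (sym (ℤ.*-identityʳ (ℤ.+ m))) (sym (ℤ.*-identityʳ (ℤ.+ n))) (ℤ.+≤+ m≤n)))

fromℕ-mono-< : ∀ {m n} → m ℕ.< n → fromℕ m < fromℕ n
fromℕ-mono-< {m} {n} m<n = subst₂ _<_ (sym (fromℕ≡fromℤ m)) (sym (fromℕ≡fromℤ n))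
  (ℚ.*<* (subst₂ ℤ._<_ (sym (ℤ.*-identityʳ (ℤ.+ m))) (sym (ℤ.*-identityʳ (ℤ.+ n))) (ℤ.+<+ m<n)))

fromℕ-cancel-≤ : ∀ {m n} → fromℕ m ≤ fromℕ n → m ℕ.≤ n
fromℕ-cancel-≤ {m} {n} p with ℕ.≤-<-connex m n
... | inj₁ m≤n = m≤n
... | inj₂ n<m = contradiction (≤-<-trans p (fromℕ-mono-< n<m)) (<-irrefl {fromℕ m} refl)

0≤fromℕ : ∀ n → 0ℚ ≤ fromℕ n
0≤fromℕ n = fromℕ-mono-≤ {0} {n} ℕ.z≤n

0<1 : 0ℚ < 1ℚ
0<1 = fromℕ-mono-< {0} {1} (ℕ.s≤s ℕ.z≤n)

0≤1 : 0ℚ ≤ 1ℚ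
0≤1 = <⇒≤ 0<1

≤-by-gap : ∀ {p q} d → 0ℚ ≤ d → q ≡ p + d → p ≤ q
≤-by-gap {p} d 0≤d q≡p+d = subst₂ _≤_ (+-identityʳ p) (sym q≡p+d) (+-monoʳ-≤ p 0≤d)

<-by-gap : ∀ {p q} d → 0ℚ < d → q ≡ p + d → p < q
<-by-gap {p} d 0<d q≡p+d = subst₂ _<_ (+-identityʳ p) (sym q≡p+d) (+-monoʳ-< p 0<d)

p≤q⇒0≤q-p : ∀ {p q} → p ≤ q → 0ℚ ≤ q - p
p≤q⇒0≤q-p {p} {q} p≤q = subst (_≤ q - p) (+-inverseʳ p) (+-monoˡ-≤ (- p) p≤q)

+-nonNeg : ∀ {p q} → 0ℚ ≤ p → 0ℚ ≤ q → 0ℚ ≤ p + q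
+-nonNeg = +-mono-≤

*-nonNeg : ∀ {p q} → 0ℚ ≤ p → 0ℚ ≤ q → 0ℚ ≤ p * q
*-nonNeg {p} {q} 0≤p 0≤q = subst (_≤ p * q) (*-zeroˡ q) (*-monoʳ-≤-nonNeg q {{ℚ.nonNegative 0≤q}} 0≤p)

*-pos : ∀ {p q} → 0ℚ < p → 0ℚ < q → 0ℚ < p * q
*-pos {p} {q} 0<p 0<q = subst (_< p * q) (*-zeroˡ q) (*-monoˡ-<-pos q {{ℚ.positive 0<q}} 0<p)

*-monoʳ-≤ : ∀ {p q} r → 0ℚ ≤ r → p ≤ q → p * r ≤ q * r
*-monoʳ-≤ r 0≤r = *-monoʳ-≤-nonNeg r {{ℚ.nonNegative 0≤r}}

*-monoˡ-≤ : ∀ {p q} r → 0ℚ ≤ r → p ≤ q → r * p ≤ r * q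
*-monoˡ-≤ r 0≤r = *-monoˡ-≤-nonNeg r {{ℚ.nonNegative 0≤r}}

*-mono-≤ : ∀ {p q r s} → 0ℚ ≤ p → 0ℚ ≤ r → p ≤ q → r ≤ s → p * r ≤ q * s
*-mono-≤ {q = q} {r} 0≤p 0≤r p≤q r≤s = ≤-trans (*-monoʳ-≤ r 0≤r p≤q) (*-monoˡ-≤ q (≤-trans 0≤p p≤q) r≤s)

0≤p*p : ∀ p → 0ℚ ≤ p * p
0≤p*p p with ≤-total 0ℚ p
... | inj₁ 0≤p = *-nonNeg 0≤p 0≤p
... | inj₂ p≤0 = subst (0ℚ ≤_) (neg-square p) (*-nonNeg (p≤q⇒0≤q-p p≤0) (p≤q⇒0≤q-p p≤0))
  where
  neg-square : ∀ p → (0ℚ - p) * (0ℚ - p) ≡ p * p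
  neg-square = solve-∀ ℚ-ring

p*p<q*q⇒p<q : ∀ {p q} → 0ℚ ≤ q → p * p < q * q → p < q
p*p<q*q⇒p<q {p} {q} 0≤q p²<q² with <-cmp p q
... | tri< p<q _ _ = p<q
... | tri≈ _ refl _ = contradiction p²<q² (<-irrefl refl)
... | tri> _ _ q<p = contradiction (<-≤-trans p²<q² (*-mono-≤ 0≤q 0≤q (<⇒≤ q<p) (<⇒≤ q<p))) (<-irrefl refl)

p+p<q+q⇒p<q : ∀ {p q} → p + p < q + q → p < q
p+p<q+q⇒p<q {p} {q} 2p<2q = ≰⇒> λ q≤p → <-irrefl refl (<-≤-trans 2p<2q (+-mono-≤ q≤p q≤p))

_⁻¹ : ℚ → ℚ
q ⁻¹ = 1ℚ ÷ q

÷≡*⁻¹ : ∀ p q → p ÷ q ≡ p * q ⁻¹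
÷≡*⁻¹ p q with q ℚ.≟ 0ℚ
... | yes _  = sym (*-zeroʳ p)
... | no q≢0 = cong (p *_) (sym (*-identityˡ (1/ q)))
  where instance _ = ℚ.≢-nonZero q≢0

p*p⁻¹≡1 : ∀ {p} → 0ℚ < p → p * p ⁻¹ ≡ 1ℚ
p*p⁻¹≡1 {p} 0<p with p ℚ.≟ 0ℚ
... | yes p≡0 = contradiction (sym p≡0) (<⇒≢ 0<p)
... | no p≢0  = trans (cong (p *_) (*-identityˡ (1/ p))) (*-inverseʳ p)
  where instance _ = ℚ.≢-nonZero p≢0

0<p⇒0<p⁻¹ : ∀ {p} → 0ℚ < p → 0ℚ < p ⁻¹
0<p⇒0<p⁻¹ {p} 0<p = ≰⇒> λ p⁻¹≤0 → <-irrefl refl (<-≤-trans 0<1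
  (subst₂ _≤_ (p*p⁻¹≡1 0<p) (*-zeroʳ p) (*-monoˡ-≤ p (<⇒≤ 0<p) p⁻¹≤0)))

p÷q*q≡p : ∀ p {q} → 0ℚ < q → (p ÷ q) * q ≡ p
p÷q*q≡p p {q} 0<q = begin
  (p ÷ q) * q     ≡⟨ cong (_* q) (÷≡*⁻¹ p q) ⟩
  p * q ⁻¹ * q    ≡⟨ *-assoc p (q ⁻¹) q ⟩
  p * (q ⁻¹ * q)  ≡⟨ cong (p *_) (trans (*-comm (q ⁻¹) q) (p*p⁻¹≡1 0<q)) ⟩
  p * 1ℚ          ≡⟨ *-identityʳ p ⟩
  p               ∎
  where open ≡-Reasoning

1≤p⇒p⁻¹≤1 : ∀ {p} → 1ℚ ≤ p → p ⁻¹ ≤ 1ℚ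
1≤p⇒p⁻¹≤1 {p} 1≤p = subst₂ _≤_ (*-identityʳ (p ⁻¹)) (trans (*-comm (p ⁻¹) p) (p*p⁻¹≡1 0<p))
  (*-monoˡ-≤ (p ⁻¹) (<⇒≤ (0<p⇒0<p⁻¹ 0<p)) 1≤p)
  where 0<p = <-≤-trans 0<1 1≤p

p÷q≤1⇒p≤q : ∀ {p q} → 0ℚ < q → p ÷ q ≤ 1ℚ → p ≤ q
p÷q≤1⇒p≤q {p} {q} 0<q p/q≤1 = subst₂ _≤_ (p÷q*q≡p p 0<q) (*-identityˡ q) (*-monoʳ-≤ q (<⇒≤ 0<q) p/q≤1)

÷-nonNeg : ∀ {p q} → 0ℚ ≤ p → 0ℚ < q → 0ℚ ≤ p ÷ q
÷-nonNeg {p} {q} 0≤p 0<q = subst (0ℚ ≤_) (sym (÷≡*⁻¹ p q)) (*-nonNeg 0≤p (<⇒≤ (0<p⇒0<p⁻¹ 0<q)))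

p*q<r⇒p<r÷q : ∀ {p q r} → 0ℚ < q → p * q < r → p < r ÷ q
p*q<r⇒p<r÷q {p} {q} {r} 0<q pq<r = *-cancelʳ-<-nonNeg q {{ℚ.nonNegative (<⇒≤ 0<q)}} (subst (p * q <_) (sym (p÷q*q≡p r 0<q)) pq<r)

ratio≤⇒2cp≤[2x-1]q : ∀ {p q x c D} → 0ℚ < q → 0ℚ < D → 0ℚ ≤ p → c ≤ D →
           p ÷ q ≤ (x - ½) ÷ D → fromℕ 2 * c * p ≤ (fromℕ 2 * x - 1ℚ) * q
ratio≤⇒2cp≤[2x-1]q {p} {q} {x} {c} {D} 0<q 0<D 0≤p c≤D p/q≤ = begin
  fromℕ 2 * c * p                   ≡⟨ cong (fromℕ 2 * c *_) (sym (p÷q*q≡p p 0<q)) ⟩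
  fromℕ 2 * c * (p ÷ q * q)         ≡⟨ regroup (p ÷ q) c q ⟩
  p ÷ q * c * (fromℕ 2 * q)         ≤⟨ *-monoʳ-≤ (fromℕ 2 * q) (*-nonNeg (0≤fromℕ 2) (<⇒≤ 0<q)) r·c≤x-½ ⟩
  (x - ½) * (fromℕ 2 * q)           ≡⟨ halve x q ⟩
  (fromℕ 2 * x - 1ℚ) * q            ∎
  where
  open ≤-Reasoning
  0≤r = ÷-nonNeg 0≤p 0<q
  r·c≤x-½ : p ÷ q * c ≤ x - ½
  r·c≤x-½ = ≤-trans (*-monoˡ-≤ (p ÷ q) 0≤r c≤D)
    (subst (p ÷ q * D ≤_) (p÷q*q≡p (x - ½) 0<D) (*-monoʳ-≤ D (<⇒≤ 0<D) p/q≤))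
  regroup : ∀ r c q → fromℕ 2 * c * (r * q) ≡ r * c * (fromℕ 2 * q)
  regroup = solve-∀ ℚ-ring
  halve : ∀ x q → (x - ½) * (fromℕ 2 * q) ≡ (fromℕ 2 * x - 1ℚ) * q
  halve = solve-∀ ℚ-ring


-- Rational lower square roots

⌊√_⌋ : ℕ → ℕ
⌊√ zero ⌋ = zero
⌊√ suc m ⌋ with suc ⌊√ m ⌋ ℕ.* suc ⌊√ m ⌋ ℕ.≤? suc m
... | yes _ = suc ⌊√ m ⌋
... | no _  = ⌊√ m ⌋

⌊√⌋-bounds : ∀ m → ⌊√ m ⌋ ℕ.* ⌊√ m ⌋ ℕ.≤ m × m ℕ.< suc ⌊√ m ⌋ ℕ.* suc ⌊√ m ⌋
⌊√⌋-bounds zero = ℕ.z≤n , ℕ.s≤s ℕ.z≤n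
⌊√⌋-bounds (suc m) with suc ⌊√ m ⌋ ℕ.* suc ⌊√ m ⌋ ℕ.≤? suc m
... | yes r²≤m = r²≤m , ℕ.≤-<-trans (proj₂ (⌊√⌋-bounds m)) (ℕ.*-mono-< (ℕ.n<1+n (suc ⌊√ m ⌋)) (ℕ.n<1+n (suc ⌊√ m ⌋)))
... | no r²≰m  = ℕ.m≤n⇒m≤1+n (proj₁ (⌊√⌋-bounds m)) , ℕ.≰⇒> r²≰m

module LowerSqrt (N : ℕ) (0<N : 0 ℕ.< N) where

  ε : ℚ
  ε = fromℕ N ⁻¹

  0<ε : 0ℚ < ε
  0<ε = 0<p⇒0<p⁻¹ (fromℕ-mono-< {0} {N} 0<N)

  N*ε≡1 : fromℕ N * ε ≡ 1ℚ
  N*ε≡1 = p*p⁻¹≡1 (fromℕ-mono-< {0} {N} 0<N)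

  √⁻ : ℕ → ℚ
  √⁻ m = fromℕ ⌊√ (m ℕ.* (N ℕ.* N)) ⌋ * ε

  private
    fromℕ-scaled : ∀ m → fromℕ (m ℕ.* (N ℕ.* N)) ≡ fromℕ m * (fromℕ N * fromℕ N)
    fromℕ-scaled m = trans (fromℕ-* m (N ℕ.* N)) (cong (fromℕ m *_) (fromℕ-* N N))

    unscale : ∀ x → x * (fromℕ N * fromℕ N) * (ε * ε) ≡ x
    unscale x = begin
      x * (fromℕ N * fromℕ N) * (ε * ε)      ≡⟨ regroup x (fromℕ N) ε ⟩
      x * ((fromℕ N * ε) * (fromℕ N * ε))    ≡⟨ cong (λ t → x * (t * t)) N*ε≡1 ⟩
      x * (1ℚ * 1ℚ)                          ≡⟨ *-identityʳ x ⟩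
      x                                      ∎
      where
      open ≡-Reasoning
      regroup : ∀ x n e → x * (n * n) * (e * e) ≡ x * ((n * e) * (n * e))
      regroup = solve-∀ ℚ-ring

    square-scaled : ∀ r → fromℕ r * fromℕ r * (ε * ε) ≡ (fromℕ r * ε) * (fromℕ r * ε)
    square-scaled r = regroup (fromℕ r) ε
      where regroup : ∀ r e → r * r * (e * e) ≡ (r * e) * (r * e)
            regroup = solve-∀ ℚ-ring

  √⁻-nonNeg : ∀ m → 0ℚ ≤ √⁻ m
  √⁻-nonNeg m = *-nonNeg (0≤fromℕ ⌊√ (m ℕ.* (N ℕ.* N)) ⌋) (<⇒≤ 0<ε)

  √⁻-square-≤ : ∀ m → √⁻ m * √⁻ m ≤ fromℕ m
  √⁻-square-≤ m = subst₂ _≤_ (square-scaled r) (unscale (fromℕ m))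
    (*-monoʳ-≤ (ε * ε) (*-nonNeg (<⇒≤ 0<ε) (<⇒≤ 0<ε))
      (subst₂ _≤_ (fromℕ-* r r) (fromℕ-scaled m) (fromℕ-mono-≤ (proj₁ (⌊√⌋-bounds (m ℕ.* (N ℕ.* N)))))))
    where r = ⌊√ (m ℕ.* (N ℕ.* N)) ⌋

  <-√⁻+ε-square : ∀ m → fromℕ m < (√⁻ m + ε) * (√⁻ m + ε)
  <-√⁻+ε-square m = subst₂ _<_ (unscale (fromℕ m)) (trans (square-scaled (suc r)) (cong (λ t → t * t) step))
    (*-monoˡ-<-pos (ε * ε) {{ℚ.positive (*-pos 0<ε 0<ε)}}
      (subst₂ _<_ (fromℕ-scaled m) (fromℕ-* (suc r) (suc r)) (fromℕ-mono-< (proj₂ (⌊√⌋-bounds (m ℕ.* (N ℕ.* N)))))))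
    where
    r = ⌊√ (m ℕ.* (N ℕ.* N)) ⌋
    step : fromℕ (suc r) * ε ≡ √⁻ m + ε
    step = trans (cong (_* ε) (fromℕ-suc r)) (trans (*-distribʳ-+ ε (fromℕ r) 1ℚ) (cong (√⁻ m +_) (*-identityˡ ε)))

  1≤√⁻ : ∀ m → 1 ℕ.≤ m → 1ℚ ≤ √⁻ m
  1≤√⁻ m 1≤m = subst (_≤ √⁻ m) N*ε≡1 (*-monoʳ-≤ ε (<⇒≤ 0<ε) (fromℕ-mono-≤ N≤r))
    where
    r = ⌊√ (m ℕ.* (N ℕ.* N)) ⌋
    N≤r : N ℕ.≤ r
    N≤r = ℕ.≮⇒≥ λ r<N → ℕ.<-irrefl refl (ℕ.<-≤-trans (proj₂ (⌊√⌋-bounds (m ℕ.* (N ℕ.* N))))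
      (ℕ.≤-trans (ℕ.*-mono-≤ r<N r<N) (ℕ.m≤n*m (N ℕ.* N) m {{ℕ.>-nonZero 1≤m}})))


-- Sums over vertices and edges

𝟙 : Bool → ℚ
𝟙 b = if b then 1ℚ else 0ℚ

∑-mono-≤ : ∀ {f g : Fin n → ℚ} → (∀ x → f x ≤ g x) → ∑[ x < n ] f x ≤ ∑[ x < n ] g x
∑-mono-≤ {zero}  f≤g = ≤-refl
∑-mono-≤ {suc n} f≤g = +-mono-≤ (f≤g zero) (∑-mono-≤ (f≤g ∘ suc))

∑-const : ∀ n c → ∑[ x < n ] c ≡ fromℕ n * c
∑-const zero    c = sym (*-zeroˡ c)
∑-const (suc n) c = begin
  c + ∑[ x < n ] c      ≡⟨ cong (c +_) (∑-const n c) ⟩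
  c + fromℕ n * c       ≡⟨ regroup c (fromℕ n) ⟩
  (fromℕ n + 1ℚ) * c    ≡⟨ cong (_* c) (sym (fromℕ-suc n)) ⟩
  fromℕ (suc n) * c     ∎
  where
  open ≡-Reasoning
  regroup : ∀ c m → c + m * c ≡ (m + 1ℚ) * c
  regroup = solve-∀ ℚ-ring

∑-zero : ∀ n → ∑[ x < n ] 0ℚ ≡ 0ℚ
∑-zero n = trans (∑-const n 0ℚ) (*-zeroʳ (fromℕ n))

∑-pointMass : ∀ (v : Fin n) (f : Fin n → ℚ) → ∑[ x < n ] (if ⌊ x ≟ v ⌋ then f x else 0ℚ) ≡ f v
∑-pointMass {suc n} zero    f = trans (cong (f zero +_) (∑-zero n)) (+-identityʳ (f zero))
∑-pointMass {suc n} (suc v) f = begin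
  0ℚ + ∑[ x < n ] (if ⌊ suc x ≟ suc v ⌋ then f (suc x) else 0ℚ)  ≡⟨ +-identityˡ _ ⟩
  ∑[ x < n ] (if ⌊ suc x ≟ suc v ⌋ then f (suc x) else 0ℚ)       ≡⟨ sum-cong-≗ (λ x → cong (if_then f (suc x) else 0ℚ) (suc≟suc x)) ⟩
  ∑[ x < n ] (if ⌊ x ≟ v ⌋ then f (suc x) else 0ℚ)               ≡⟨ ∑-pointMass v (f ∘ suc) ⟩
  f (suc v)                                                      ∎
  where
  open ≡-Reasoning
  suc≟suc : ∀ x → ⌊ suc x ≟ suc v ⌋ ≡ ⌊ x ≟ v ⌋
  suc≟suc x = ⌊⌋-map′ (cong suc) Fin.suc-injective (x ≟ v)

sumℚ-map-++ : ∀ {X : Set} (w : X → ℚ) xs ys → sumℚ (map w (xs ++ ys)) ≡ sumℚ (map w xs) + sumℚ (map w ys)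
sumℚ-map-++ w []       ys = sym (+-identityˡ _)
sumℚ-map-++ w (x ∷ xs) ys = trans (cong (w x +_) (sumℚ-map-++ w xs ys)) (sym (+-assoc (w x) _ _))

sumℚ-concatMap : ∀ {X Y : Set} (w : Y → ℚ) (f : X → List Y) xs →
                 sumℚ (map w (concatMap f xs)) ≡ sumℚ (map (λ x → sumℚ (map w (f x))) xs)
sumℚ-concatMap w f []       = refl
sumℚ-concatMap w f (x ∷ xs) = trans (sumℚ-map-++ w (f x) (concatMap f xs)) (cong (sumℚ (map w (f x)) +_) (sumℚ-concatMap w f xs))

sumℚ-allFin : ∀ (g : Fin n → ℚ) → sumℚ (map g (allFin n)) ≡ ∑[ x < n ] g x
sumℚ-allFin g = trans (cong sumℚ (List.map-tabulate id g)) (sumℚ-tabulate g)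
  where
  sumℚ-tabulate : ∀ {n} (g : Fin n → ℚ) → sumℚ (tabulate g) ≡ ∑[ x < n ] g x
  sumℚ-tabulate {zero}  g = refl
  sumℚ-tabulate {suc n} g = cong (g zero +_) (sumℚ-tabulate (g ∘ suc))

_≺_ : Fin n → Fin n → Bool
x ≺ y = ⌊ toℕ x ℕ.<? toℕ y ⌋

edgeSum : Adj n → (Fin n → Fin n → ℚ) → ℚ
edgeSum {n} A w = ∑[ x < n ] ∑[ y < n ] (if A x y ∧ x ≺ y then w x y else 0ℚ)

adjSum : Adj n → (Fin n → Fin n → ℚ) → ℚ
adjSum {n} A w = ∑[ x < n ] ∑[ y < n ] (if A x y then w x y else 0ℚ)

sumℚ-edges : ∀ (A : Adj n) (w : Fin n × Fin n → ℚ) → sumℚ (map w (edges A)) ≡ edgeSum A (λ x y → w (x , y))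
sumℚ-edges {n} A w = begin
  sumℚ (map w (edges A))
    ≡⟨ sumℚ-concatMap w _ (allFin n) ⟩
  sumℚ (map (λ x → sumℚ (map w (concatMap (edgesFrom x) (allFin n)))) (allFin n))
    ≡⟨ sumℚ-allFin (λ x → sumℚ (map w (concatMap (edgesFrom x) (allFin n)))) ⟩
  ∑[ x < n ] sumℚ (map w (concatMap (edgesFrom x) (allFin n)))
    ≡⟨ sum-cong-≗ (λ x → trans (sumℚ-concatMap w (edgesFrom x) (allFin n)) (sumℚ-allFin (λ y → sumℚ (map w (edgesFrom x y))))) ⟩
  ∑[ x < n ] ∑[ y < n ] sumℚ (map w (edgesFrom x y))
    ≡⟨ sum-cong-≗ (λ x → sum-cong-≗ (λ y → sumℚ-singleton (A x y ∧ x ≺ y) (x , y))) ⟩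
  edgeSum A (λ x y → w (x , y))
    ∎
  where
  open ≡-Reasoning
  edgesFrom : Fin n → Fin n → List (Fin n × Fin n)
  edgesFrom x y = if A x y ∧ x ≺ y then (x , y) ∷ [] else []
  sumℚ-singleton : ∀ b p → sumℚ (map w (if b then p ∷ [] else [])) ≡ (if b then w p else 0ℚ)
  sumℚ-singleton true  p = +-identityʳ (w p)
  sumℚ-singleton false p = refl

∑∑-distrib-+ : ∀ (f g : Fin n → Fin n → ℚ) →
               ∑[ x < n ] ∑[ y < n ] (f x y + g x y) ≡ ∑[ x < n ] ∑[ y < n ] f x y + ∑[ x < n ] ∑[ y < n ] g x y
∑∑-distrib-+ {n} f g = trans (sum-cong-≗ (λ x → ∑-distrib-+ (f x) (g x))) (∑-distrib-+ (λ x → ∑[ y < n ] f x y) _)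

⌊⌋-true : ∀ {P : Set} (p? : Dec P) → P → ⌊ p? ⌋ ≡ true
⌊⌋-true p? p = trans (isYes≗does p?) (dec-true p? p)

⌊⌋-false : ∀ {P : Set} (p? : Dec P) → ¬ P → ⌊ p? ⌋ ≡ false
⌊⌋-false p? ¬p = trans (isYes≗does p?) (dec-false p? ¬p)

≺-connex : ∀ {x y : Fin n} → x ≢ y → (x ≺ y ≡ true × y ≺ x ≡ false) ⊎ (x ≺ y ≡ false × y ≺ x ≡ true)
≺-connex {x = x} {y} x≢y with ℕ.<-cmp (toℕ x) (toℕ y)
... | tri< x<y _ y≮x = inj₁ (⌊⌋-true (toℕ x ℕ.<? toℕ y) x<y , ⌊⌋-false (toℕ y ℕ.<? toℕ x) y≮x)
... | tri≈ _ x≡y _   = contradiction (Fin.toℕ-injective x≡y) x≢y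
... | tri> x≮y _ y<x = inj₂ (⌊⌋-false (toℕ x ℕ.<? toℕ y) x≮y , ⌊⌋-true (toℕ y ℕ.<? toℕ x) y<x)

adjSum≡edgeSum+edgeSum : ∀ (A : Adj n) → symmetric A → loopless A → ∀ w → (∀ x y → w x y ≡ w y x) →
                         adjSum A w ≡ edgeSum A w + edgeSum A w
adjSum≡edgeSum+edgeSum {n} A A-sym A-loopless w w-sym = begin
  adjSum A w                                                        ≡⟨ sum-cong-≗ (λ x → sum-cong-≗ (split x)) ⟩
  ∑[ x < n ] ∑[ y < n ] (forward x y + forward y x)                 ≡⟨ ∑∑-distrib-+ forward (λ x y → forward y x) ⟩
  edgeSum A w + ∑[ x < n ] ∑[ y < n ] forward y x                   ≡⟨ cong (edgeSum A w +_) (∑-comm (λ x y → forward y x)) ⟩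
  edgeSum A w + edgeSum A w                                         ∎
  where
  open ≡-Reasoning
  forward : Fin n → Fin n → ℚ
  forward x y = if A x y ∧ x ≺ y then w x y else 0ℚ
  split : ∀ x y → (if A x y then w x y else 0ℚ) ≡ forward x y + forward y x
  split x y with x ≟ y
  ... | yes refl rewrite A-loopless x = refl
  ... | no x≢y rewrite A-sym y x with A x y | ≺-connex x≢y
  ...   | false | _                = refl
  ...   | true  | inj₁ (x≺y , y⊀x) rewrite x≺y | y⊀x = sym (+-identityʳ (w x y))
  ...   | true  | inj₂ (x⊀y , y≺x) rewrite x⊀y | y≺x = trans (w-sym x y) (sym (+-identityˡ (w y x)))

fromℕ-sum : ∀ xs → fromℕ (foldr ℕ._+_ 0 xs) ≡ sumℚ (map fromℕ xs)
fromℕ-sum []       = refl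
fromℕ-sum (x ∷ xs) = trans (fromℕ-+ x (foldr ℕ._+_ 0 xs)) (cong (fromℕ x +_) (fromℕ-sum xs))

∑-adjacent : ∀ (A : Adj n) x c → ∑[ y < n ] (if A x y then c else 0ℚ) ≡ fromℕ (deg A x) * c
∑-adjacent {n} A x c = sym (begin
  fromℕ (deg A x) * c                            ≡⟨ cong (_* c) (fromℕ-sum (map edge? (allFin n))) ⟩
  sumℚ (map fromℕ (map edge? (allFin n))) * c    ≡⟨ cong (λ xs → sumℚ xs * c) (sym (List.map-∘ (allFin n))) ⟩
  sumℚ (map (fromℕ ∘ edge?) (allFin n)) * c      ≡⟨ cong (_* c) (sumℚ-allFin (fromℕ ∘ edge?)) ⟩
  (∑[ y < n ] fromℕ (edge? y)) * c               ≡⟨ *-distribʳ-sum c (fromℕ ∘ edge?) ⟩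
  ∑[ y < n ] (fromℕ (edge? y) * c)               ≡⟨ sum-cong-≗ (λ y → indicator (A x y)) ⟩
  ∑[ y < n ] (if A x y then c else 0ℚ)           ∎)
  where
  open ≡-Reasoning
  edge? : Fin n → ℕ
  edge? y = if A x y then 1 else 0
  indicator : ∀ b → fromℕ (if b then 1 else 0) * c ≡ (if b then c else 0ℚ)
  indicator true  = *-identityˡ c
  indicator false = *-zeroˡ c

adjSum-handshake : ∀ (A : Adj n) → symmetric A → (f : Fin n → ℚ) →
                   adjSum A (λ x y → f x + f y) ≡ ∑[ x < n ] (fromℕ (deg A x) * f x) + ∑[ x < n ] (fromℕ (deg A x) * f x)
adjSum-handshake {n} A A-sym f = begin
  adjSum A (λ x y → f x + f y)                         ≡⟨ sum-cong-≗ (λ x → sum-cong-≗ (split x)) ⟩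
  ∑[ x < n ] ∑[ y < n ] (atSource x y + atSource y x)  ≡⟨ ∑∑-distrib-+ atSource (λ x y → atSource y x) ⟩
  ∑∑source + ∑[ x < n ] ∑[ y < n ] atSource y x        ≡⟨ cong (∑∑source +_) (∑-comm (λ x y → atSource y x)) ⟩
  ∑∑source + ∑∑source                                  ≡⟨ cong₂ _+_ degrees degrees ⟩
  ∑[ x < n ] (fromℕ (deg A x) * f x) + ∑[ x < n ] (fromℕ (deg A x) * f x) ∎
  where
  open ≡-Reasoning
  atSource : Fin n → Fin n → ℚ
  atSource x y = if A x y then f x else 0ℚ
  ∑∑source = ∑[ x < n ] ∑[ y < n ] atSource x y
  split : ∀ x y → (if A x y then f x + f y else 0ℚ) ≡ atSource x y + atSource y x
  split x y rewrite A-sym y x with A x y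
  ... | true  = refl
  ... | false = refl
  degrees : ∑∑source ≡ ∑[ x < n ] (fromℕ (deg A x) * f x)
  degrees = sum-cong-≗ (λ x → ∑-adjacent A x (f x))

adjSum-mono-≤ : ∀ (A : Adj n) {w w′} → (∀ x y → A x y ≡ true → w x y ≤ w′ x y) → adjSum A w ≤ adjSum A w′
adjSum-mono-≤ A {w} {w′} w≤w′ = ∑-mono-≤ (λ x → ∑-mono-≤ (pointwise x))
  where
  pointwise : ∀ x y → (if A x y then w x y else 0ℚ) ≤ (if A x y then w′ x y else 0ℚ)
  pointwise x y with A x y in Axy
  ... | true  = w≤w′ x y Axy
  ... | false = ≤-refl

adjSum-+ : ∀ (A : Adj n) w w′ → adjSum A (λ x y → w x y + w′ x y) ≡ adjSum A w + adjSum A w′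
adjSum-+ A w w′ = trans (sum-cong-≗ (λ x → sum-cong-≗ (λ y → if-distrib (A x y))))
                        (∑∑-distrib-+ (λ x y → if A x y then w x y else 0ℚ) _)
  where
  if-distrib : ∀ {p q} b → (if b then p + q else 0ℚ) ≡ (if b then p else 0ℚ) + (if b then q else 0ℚ)
  if-distrib true  = refl
  if-distrib false = refl

degree≡∑ : ∀ (A : Adj n) x → fromℕ (deg A x) ≡ ∑[ y < n ] 𝟙 (A x y)
degree≡∑ A x = sym (trans (∑-adjacent A x 1ℚ) (*-identityʳ (fromℕ (deg A x))))

term-≤-∑ : ∀ {f : Fin n → ℚ} → (∀ x → 0ℚ ≤ f x) → ∀ u → f u ≤ ∑[ x < n ] f x
term-≤-∑ {suc n} {f} 0≤f zero    = ≤-by-gap (∑[ x < n ] f (suc x)) (subst (_≤ ∑[ x < n ] f (suc x)) (∑-zero n) (∑-mono-≤ (0≤f ∘ suc))) refl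
term-≤-∑ {suc n} {f} 0≤f (suc u) = ≤-trans (term-≤-∑ (0≤f ∘ suc) u) (≤-by-gap (f zero) (0≤f zero) (+-comm (f zero) _))

1≤deg : ∀ (A : Adj n) {x y} → A x y ≡ true → 1ℚ ≤ fromℕ (deg A x)
1≤deg A {x} {y} Axy = subst (1ℚ ≤_) (sym (degree≡∑ A x))
  (subst (_≤ _) (cong 𝟙 Axy) (term-≤-∑ (λ z → indicator-nonNeg (A x z)) y))
  where
  indicator-nonNeg : ∀ b → 0ℚ ≤ 𝟙 b
  indicator-nonNeg true  = 0≤1
  indicator-nonNeg false = ≤-refl

deg≤n : ∀ (A : Adj n) x → fromℕ (deg A x) ≤ fromℕ n
deg≤n {n} A x = subst₂ _≤_ (sym (degree≡∑ A x)) (trans (∑-const n 1ℚ) (*-identityʳ (fromℕ n)))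
  (∑-mono-≤ (λ y → indicator-≤-1 (A x y)))
  where
  indicator-≤-1 : ∀ b → 𝟙 b ≤ 1ℚ
  indicator-≤-1 true  = ≤-refl
  indicator-≤-1 false = 0≤1

-- Deleting an edge

∑-if-∧-pointMass : ∀ a (v : Fin n) (f : Fin n → ℚ) →
                   ∑[ y < n ] (if a ∧ ⌊ y ≟ v ⌋ then f y else 0ℚ) ≡ (if a then f v else 0ℚ)
∑-if-∧-pointMass true  v f = ∑-pointMass v f
∑-if-∧-pointMass {n} false v f = ∑-zero n

∑∑-pointMass : ∀ (u v : Fin n) (w : Fin n → Fin n → ℚ) →
               ∑[ x < n ] ∑[ y < n ] (if ⌊ x ≟ u ⌋ ∧ ⌊ y ≟ v ⌋ then w x y else 0ℚ) ≡ w u v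
∑∑-pointMass u v w = trans (sum-cong-≗ (λ x → ∑-if-∧-pointMass ⌊ x ≟ u ⌋ v (w x))) (∑-pointMass u (λ x → w x v))

≟-sound : ∀ {x y : Fin n} → ⌊ x ≟ y ⌋ ≡ true → x ≡ y
≟-sound {x = x} {y} eq with x ≟ y
... | yes x≡y = x≡y

∧-sound : ∀ {a b} → a ∧ b ≡ true → a ≡ true × b ≡ true
∧-sound {true} b≡true = refl , b≡true

if-removed : ∀ g c₁ c₂ (c : ℚ) → (c₁ ≡ true → g ≡ true) → (c₂ ≡ true → g ≡ true) → (c₁ ≡ true → c₂ ≡ false) →
             (if g then c else 0ℚ) ≡ (if (if c₁ ∨ c₂ then false else g) then c else 0ℚ) + (if c₁ then c else 0ℚ) + (if c₂ then c else 0ℚ)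
if-removed g true  true  c _  _  c₁⇒¬c₂ = contradiction (c₁⇒¬c₂ refl) λ ()
if-removed g true  false c c₁⇒g _ _ rewrite c₁⇒g refl = sym (trans (+-identityʳ (0ℚ + c)) (+-identityˡ c))
if-removed g false true  c _ c₂⇒g _ rewrite c₂⇒g refl = sym (+-identityˡ c)
if-removed g false false c _ _ _ = sym (trans (+-identityʳ _) (+-identityʳ _))

module EdgeDeletion {n} (G : Adj n) (G-sym : symmetric G) (G-loopless : loopless G)
                    (i j : Fin n) (Gij : G i j ≡ true) where

  H : Adj n
  H = deleteEdge G i j

  Gji : G j i ≡ true
  Gji = trans (G-sym j i) Gij

  i≢j : i ≢ j
  i≢j refl = contradiction (trans (sym (G-loopless i)) Gij) λ ()

  isIJ isJI : Fin n → Fin n → Bool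
  isIJ x y = ⌊ x ≟ i ⌋ ∧ ⌊ y ≟ j ⌋
  isJI x y = ⌊ x ≟ j ⌋ ∧ ⌊ y ≟ i ⌋

  H-sym : symmetric H
  H-sym x y = cong₂ (λ c g → if c then false else g)
    (trans (cong₂ _∨_ (Bool.∧-comm ⌊ x ≟ i ⌋ ⌊ y ≟ j ⌋) (Bool.∧-comm ⌊ x ≟ j ⌋ ⌊ y ≟ i ⌋)) (Bool.∨-comm (isJI y x) (isIJ y x)))
    (G-sym x y)

  H-loopless : loopless H
  H-loopless x with isIJ x x ∨ isJI x x
  ... | true  = refl
  ... | false = G-loopless x

  H-ij : H i j ≡ false
  H-ij rewrite ⌊⌋-true (i ≟ i) refl | ⌊⌋-true (j ≟ j) refl = refl

  H-ji : H j i ≡ false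
  H-ji rewrite ⌊⌋-true (j ≟ j) refl | ⌊⌋-true (i ≟ i) refl | ⌊⌋-false (j ≟ i) (λ j≡i → i≢j (sym j≡i)) = refl

  H⊆G : ∀ {x y} → H x y ≡ true → G x y ≡ true
  H⊆G {x} {y} Hxy with isIJ x y ∨ isJI x y
  ... | false = Hxy

  private
    isIJ-sound : ∀ {x y} → isIJ x y ≡ true → x ≡ i × y ≡ j
    isIJ-sound {x} {y} eq with ∧-sound {⌊ x ≟ i ⌋} eq
    ... | x≟i , y≟j = ≟-sound {x = x} x≟i , ≟-sound {x = y} y≟j

    isJI-sound : ∀ {x y} → isJI x y ≡ true → x ≡ j × y ≡ i
    isJI-sound {x} {y} eq with ∧-sound {⌊ x ≟ j ⌋} eq
    ... | x≟j , y≟i = ≟-sound {x = x} x≟j , ≟-sound {x = y} y≟i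

    isIJ⇒G : ∀ {x y} → isIJ x y ≡ true → G x y ≡ true
    isIJ⇒G {x} {y} eq with isIJ-sound {x} {y} eq
    ... | refl , refl = Gij

    isJI⇒G : ∀ {x y} → isJI x y ≡ true → G x y ≡ true
    isJI⇒G {x} {y} eq with isJI-sound {x} {y} eq
    ... | refl , refl = Gji

    isIJ⇒¬isJI : ∀ {x y} → isIJ x y ≡ true → isJI x y ≡ false
    isIJ⇒¬isJI {x} {y} eq with isIJ-sound {x} {y} eq
    ... | refl , _ rewrite ⌊⌋-false (i ≟ j) i≢j = refl

  if-deleteEdge : ∀ x y (c : ℚ) →
    (if G x y then c else 0ℚ) ≡ (if H x y then c else 0ℚ) + (if isIJ x y then c else 0ℚ) + (if isJI x y then c else 0ℚ)
  if-deleteEdge x y c = if-removed (G x y) (isIJ x y) (isJI x y) c (isIJ⇒G {x} {y}) (isJI⇒G {x} {y}) (isIJ⇒¬isJI {x} {y})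

  adjSum-deleteEdge : ∀ w → adjSum G w ≡ adjSum H w + w i j + w j i
  adjSum-deleteEdge w = begin
    adjSum G w
      ≡⟨ sum-cong-≗ (λ x → sum-cong-≗ (λ y → if-deleteEdge x y (w x y))) ⟩
    ∑[ x < n ] ∑[ y < n ] ((if H x y then w x y else 0ℚ) + (if isIJ x y then w x y else 0ℚ) + (if isJI x y then w x y else 0ℚ))
      ≡⟨ ∑∑-distrib-+ (λ x y → (if H x y then w x y else 0ℚ) + (if isIJ x y then w x y else 0ℚ)) _ ⟩
    ∑[ x < n ] ∑[ y < n ] ((if H x y then w x y else 0ℚ) + (if isIJ x y then w x y else 0ℚ)) + ∑[ x < n ] ∑[ y < n ] (if isJI x y then w x y else 0ℚ)
      ≡⟨ cong₂ _+_ (∑∑-distrib-+ (λ x y → if H x y then w x y else 0ℚ) _) (∑∑-pointMass j i w) ⟩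
    adjSum H w + ∑[ x < n ] ∑[ y < n ] (if isIJ x y then w x y else 0ℚ) + w j i
      ≡⟨ cong (λ t → adjSum H w + t + w j i) (∑∑-pointMass i j w) ⟩
    adjSum H w + w i j + w j i
      ∎
    where open ≡-Reasoning

  deg-deleteEdge : ∀ v → fromℕ (deg G v) ≡ fromℕ (deg H v) + 𝟙 ⌊ v ≟ i ⌋ + 𝟙 ⌊ v ≟ j ⌋
  deg-deleteEdge v = begin
    fromℕ (deg G v)
      ≡⟨ degree≡∑ G v ⟩
    ∑[ y < n ] 𝟙 (G v y)
      ≡⟨ sum-cong-≗ (λ y → if-deleteEdge v y 1ℚ) ⟩
    ∑[ y < n ] (𝟙 (H v y) + 𝟙 (isIJ v y) + 𝟙 (isJI v y))
      ≡⟨ ∑-distrib-+ (λ y → 𝟙 (H v y) + 𝟙 (isIJ v y)) _ ⟩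
    ∑[ y < n ] (𝟙 (H v y) + 𝟙 (isIJ v y)) + ∑[ y < n ] 𝟙 (isJI v y)
      ≡⟨ cong₂ _+_ (∑-distrib-+ (λ y → 𝟙 (H v y)) _) (∑-if-∧-pointMass ⌊ v ≟ j ⌋ i (λ _ → 1ℚ)) ⟩
    ∑[ y < n ] 𝟙 (H v y) + ∑[ y < n ] 𝟙 (isIJ v y) + 𝟙 ⌊ v ≟ j ⌋
      ≡⟨ cong₂ (λ s t → s + t + 𝟙 ⌊ v ≟ j ⌋) (sym (degree≡∑ H v)) (∑-if-∧-pointMass ⌊ v ≟ i ⌋ j (λ _ → 1ℚ)) ⟩
    fromℕ (deg H v) + 𝟙 ⌊ v ≟ i ⌋ + 𝟙 ⌊ v ≟ j ⌋
      ∎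
    where open ≡-Reasoning

  deg-deleteEdge-i : fromℕ (deg H i) ≡ fromℕ (deg G i) - 1ℚ
  deg-deleteEdge-i = begin
    fromℕ (deg H i)                                     ≡⟨ restore (fromℕ (deg H i)) ⟩
    fromℕ (deg H i) + 𝟙 true + 𝟙 false - 1ℚ             ≡⟨ cong₂ (λ s t → fromℕ (deg H i) + 𝟙 s + 𝟙 t - 1ℚ)
                                                             (sym (⌊⌋-true (i ≟ i) refl)) (sym (⌊⌋-false (i ≟ j) i≢j)) ⟩
    fromℕ (deg H i) + 𝟙 ⌊ i ≟ i ⌋ + 𝟙 ⌊ i ≟ j ⌋ - 1ℚ     ≡⟨ cong (_- 1ℚ) (sym (deg-deleteEdge i)) ⟩
    fromℕ (deg G i) - 1ℚ                                ∎
    where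
    open ≡-Reasoning
    restore : ∀ d → d ≡ d + 1ℚ + 0ℚ - 1ℚ
    restore = solve-∀ ℚ-ring

  deg-deleteEdge-j : fromℕ (deg H j) ≡ fromℕ (deg G j) - 1ℚ
  deg-deleteEdge-j = begin
    fromℕ (deg H j)                                     ≡⟨ restore (fromℕ (deg H j)) ⟩
    fromℕ (deg H j) + 𝟙 false + 𝟙 true - 1ℚ             ≡⟨ cong₂ (λ s t → fromℕ (deg H j) + 𝟙 s + 𝟙 t - 1ℚ)
                                                             (sym (⌊⌋-false (j ≟ i) (i≢j ∘ sym))) (sym (⌊⌋-true (j ≟ j) refl)) ⟩
    fromℕ (deg H j) + 𝟙 ⌊ j ≟ i ⌋ + 𝟙 ⌊ j ≟ j ⌋ - 1ℚ     ≡⟨ cong (_- 1ℚ) (sym (deg-deleteEdge j)) ⟩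
    fromℕ (deg G j) - 1ℚ                                ∎
    where
    open ≡-Reasoning
    restore : ∀ d → d ≡ d + 0ℚ + 1ℚ - 1ℚ
    restore = solve-∀ ℚ-ring

  deg-deleteEdge-other : ∀ {v} → v ≢ i → v ≢ j → fromℕ (deg H v) ≡ fromℕ (deg G v)
  deg-deleteEdge-other {v} v≢i v≢j = begin
    fromℕ (deg H v)                                     ≡⟨ sym (trans (+-identityʳ (fromℕ (deg H v) + 0ℚ)) (+-identityʳ (fromℕ (deg H v)))) ⟩
    fromℕ (deg H v) + 𝟙 false + 𝟙 false                 ≡⟨ cong₂ (λ s t → fromℕ (deg H v) + 𝟙 s + 𝟙 t)
                                                             (sym (⌊⌋-false (v ≟ i) v≢i)) (sym (⌊⌋-false (v ≟ j) v≢j)) ⟩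
    fromℕ (deg H v) + 𝟙 ⌊ v ≟ i ⌋ + 𝟙 ⌊ v ≟ j ⌋          ≡⟨ sym (deg-deleteEdge v) ⟩
    fromℕ (deg G v)                                     ∎
    where open ≡-Reasoning

  edgeSum-deleteEdge-< : ∀ (wG wH : Fin n → Fin n → ℚ) (b : Fin n → ℚ) →
    (∀ x y → wG x y ≡ wG y x) → (∀ x y → wH x y ≡ wH y x) →
    (∀ x y → H x y ≡ true → wH x y ≤ wG x y + (b x + b y)) →
    ∑[ x < n ] (fromℕ (deg H x) * b x) < wG i j →
    edgeSum H wH < edgeSum G wG
  edgeSum-deleteEdge-< wG wH b wG-sym wH-sym wH≤ budget<wGij = p+p<q+q⇒p<q (begin-strict
    edgeSum H wH + edgeSum H wH                     ≡⟨ sym (adjSum≡edgeSum+edgeSum H H-sym H-loopless wH wH-sym) ⟩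
    adjSum H wH                                     ≤⟨ adjSum-mono-≤ H wH≤ ⟩
    adjSum H (λ x y → wG x y + (b x + b y))         ≡⟨ adjSum-+ H wG (λ x y → b x + b y) ⟩
    adjSum H wG + adjSum H (λ x y → b x + b y)      ≡⟨ cong (adjSum H wG +_) (adjSum-handshake H H-sym b) ⟩
    adjSum H wG + (budget + budget)                 <⟨ +-monoʳ-< (adjSum H wG) (+-mono-< budget<wGij (subst (budget <_) (wG-sym i j) budget<wGij)) ⟩
    adjSum H wG + (wG i j + wG j i)                 ≡⟨ sym (trans (adjSum-deleteEdge wG) (+-assoc (adjSum H wG) (wG i j) (wG j i))) ⟩
    adjSum G wG                                     ≡⟨ adjSum≡edgeSum+edgeSum G G-sym G-loopless wG wG-sym ⟩
    edgeSum G wG + edgeSum G wG                     ∎)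
    where
    open ≤-Reasoning
    budget = ∑[ x < n ] (fromℕ (deg H x) * b x)

-- Neighbour degrees

minL-≤ : ∀ {y xs} → y ∈ xs → minL xs ℕ.≤ y
minL-≤ {y} {x ∷ xs} y∈ = List.foldr-preservesᵒ pres x xs (start y∈)
  where
  pres : ∀ a b → a ℕ.≤ y ⊎ b ℕ.≤ y → a ℕ.⊓ b ℕ.≤ y
  pres a b (inj₁ a≤y) = ℕ.m≤n⇒m⊓o≤n b a≤y
  pres a b (inj₂ b≤y) = ℕ.m≤n⇒o⊓m≤n a b≤y
  start : y ∈ x ∷ xs → x ℕ.≤ y ⊎ Any (ℕ._≤ y) xs
  start (here refl) = inj₁ ℕ.≤-refl
  start (there y∈xs) = inj₂ (Any.map (λ { refl → ℕ.≤-refl }) y∈xs)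

≤-maxL : ∀ {y xs} → y ∈ xs → y ℕ.≤ maxL xs
≤-maxL {y} {xs} y∈ = List.foldr-preservesᵒ pres 0 xs (inj₂ (Any.map (λ { refl → ℕ.≤-refl }) y∈))
  where
  pres : ∀ a b → y ℕ.≤ a ⊎ y ℕ.≤ b → y ℕ.≤ a ℕ.⊔ b
  pres a b (inj₁ y≤a) = ℕ.m≤n⇒m≤n⊔o b y≤a
  pres a b (inj₂ y≤b) = ℕ.m≤n⇒m≤o⊔n a y≤b

minL-glb : ∀ {m xs} → All (m ℕ.≤_) xs → ¬ xs ≡ [] → m ℕ.≤ minL xs
minL-glb {xs = []}     _          xs≢[] = contradiction refl xs≢[]
minL-glb {xs = x ∷ xs} (m≤x ∷ m≤xs) _ = List.foldr-preservesᵇ ℕ.⊓-glb m≤x m≤xs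

module Neighbours (G : Adj n) where

  ∈-otherNbrDegs : ∀ {v w u} → G v u ≡ true → u ≢ w → deg G u ∈ otherNbrDegs G v w
  ∈-otherNbrDegs {v} {w} {u} Gvu u≢w = ∈-concatMap⁺ _ (Any.map (λ { refl → listed }) (∈-allFin u))
    where
    listed : deg G u ∈ (if G v u ∧ (if ⌊ u ≟ w ⌋ then false else true) then deg G u ∷ [] else [])
    listed rewrite Gvu | ⌊⌋-false (u ≟ w) u≢w = here refl

  All-otherNbrDegs : ∀ {P : ℕ → Set} v w → (∀ u → G v u ≡ true → P (deg G u)) → All P (otherNbrDegs G v w)
  All-otherNbrDegs {P = P} v w P-nbr = All.concat⁺ (All.map⁺ (All.tabulate⁺ listed))
    where
    listed : ∀ u → All P (if G v u ∧ (if ⌊ u ≟ w ⌋ then false else true) then deg G u ∷ [] else [])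
    listed u with G v u in Gvu | ⌊ u ≟ w ⌋
    ... | false | _     = []
    ... | true  | true  = []
    ... | true  | false = P-nbr u Gvu ∷ []

  dmin-≤-deg : ∀ {v w u} → G v u ≡ true → u ≢ w → dmin G v w ℕ.≤ deg G u
  dmin-≤-deg Gvu u≢w = minL-≤ (∈-otherNbrDegs Gvu u≢w)

  deg-≤-dmax : ∀ {v w u} → G v u ≡ true → u ≢ w → deg G u ℕ.≤ dmax G v w
  deg-≤-dmax Gvu u≢w = ≤-maxL (∈-otherNbrDegs Gvu u≢w)

  1≤dmin : symmetric G → ∀ {v w u} → G v u ≡ true → u ≢ w → 1 ℕ.≤ dmin G v w
  1≤dmin G-sym {v} {w} Gvu u≢w = minL-glb
    (All-otherNbrDegs v w (λ u Gvu → fromℕ-cancel-≤ {1} (1≤deg G (trans (G-sym u v) Gvu))))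
    (λ { eq → nonempty (subst (deg G _ ∈_) eq (∈-otherNbrDegs Gvu u≢w)) })
    where
    nonempty : ∀ {y : ℕ} → ¬ y ∈ []
    nonempty ()

-- One endpoint losing a degree

0<8A² : ∀ {A} → 1ℚ ≤ A → 0ℚ < fromℕ 8 * A * A
0<8A² 1≤A = *-pos (*-pos (fromℕ-mono-< {0} {8} (ℕ.s≤s ℕ.z≤n)) (<-≤-trans 0<1 1≤A)) (<-≤-trans 0<1 1≤A)

-- shrink A = 1 − 1/(2A) − 1/(8A²), the Taylor polynomial of √(1 − 1/A), which it bounds from above.
shrink : ℚ → ℚ
shrink A = (fromℕ 8 * A * A - fromℕ 4 * A - 1ℚ) * (fromℕ 8 * A * A) ⁻¹

shrink-nonNeg : ∀ {A} → 1ℚ ≤ A → 0ℚ ≤ shrink A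
shrink-nonNeg {A} 1≤A = *-nonNeg (subst (0ℚ ≤_) (expand A) numerator-nonNeg) (<⇒≤ (0<p⇒0<p⁻¹ (0<8A² 1≤A)))
  where
  x = A - 1ℚ
  0≤x = p≤q⇒0≤q-p 1≤A
  numerator-nonNeg : 0ℚ ≤ fromℕ 8 * x * x + fromℕ 12 * x + fromℕ 3
  numerator-nonNeg = +-nonNeg (+-nonNeg (*-nonNeg (*-nonNeg (0≤fromℕ 8) 0≤x) 0≤x) (*-nonNeg (0≤fromℕ 12) 0≤x)) (0≤fromℕ 3)
  expand : ∀ A → fromℕ 8 * (A - 1ℚ) * (A - 1ℚ) + fromℕ 12 * (A - 1ℚ) + fromℕ 3 ≡ fromℕ 8 * A * A - fromℕ 4 * A - 1ℚ
  expand = solve-∀ ℚ-ring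

shrink-≤-1 : ∀ {A} → 1ℚ ≤ A → shrink A ≤ 1ℚ
shrink-≤-1 {A} 1≤A = ≤-by-gap ((fromℕ 4 * A + 1ℚ) * W) (*-nonNeg 0≤4A+1 (<⇒≤ (0<p⇒0<p⁻¹ (0<8A² 1≤A))))
  (trans (sym (p*p⁻¹≡1 (0<8A² 1≤A))) (split A W))
  where
  W = (fromℕ 8 * A * A) ⁻¹
  0≤4A+1 = +-nonNeg (*-nonNeg (0≤fromℕ 4) (≤-trans 0≤1 1≤A)) 0≤1
  split : ∀ A W → fromℕ 8 * A * A * W ≡ (fromℕ 8 * A * A - fromℕ 4 * A - 1ℚ) * W + (fromℕ 4 * A + 1ℚ) * W
  split = solve-∀ ℚ-ring

shrink-square : ∀ {A} → 1ℚ ≤ A → A - 1ℚ ≤ shrink A * shrink A * A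
shrink-square {A} 1≤A = ≤-by-gap ((fromℕ 8 * A * A + A) * W * W) (*-nonNeg (*-nonNeg 0≤8A²+A 0≤W) 0≤W) (begin
  shrink A * shrink A * A                                                       ≡⟨ expand A W ⟩
  (A - 1ℚ) * (fromℕ 8 * A * A * W) * (fromℕ 8 * A * A * W) + (fromℕ 8 * A * A + A) * W * W
                                                                                ≡⟨ cong (λ t → (A - 1ℚ) * t * t + (fromℕ 8 * A * A + A) * W * W) (p*p⁻¹≡1 (0<8A² 1≤A)) ⟩
  (A - 1ℚ) * 1ℚ * 1ℚ + (fromℕ 8 * A * A + A) * W * W                            ≡⟨ cong (_+ (fromℕ 8 * A * A + A) * W * W) (trans (*-identityʳ ((A - 1ℚ) * 1ℚ)) (*-identityʳ (A - 1ℚ))) ⟩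
  A - 1ℚ + (fromℕ 8 * A * A + A) * W * W                                        ∎)
  where
  open ≡-Reasoning
  W = (fromℕ 8 * A * A) ⁻¹
  0≤W = <⇒≤ (0<p⇒0<p⁻¹ (0<8A² 1≤A))
  0≤A = ≤-trans 0≤1 1≤A
  0≤8A²+A = +-nonNeg (*-nonNeg (*-nonNeg (0≤fromℕ 8) 0≤A) 0≤A) 0≤A
  expand : ∀ A W → (fromℕ 8 * A * A - fromℕ 4 * A - 1ℚ) * W * ((fromℕ 8 * A * A - fromℕ 4 * A - 1ℚ) * W) * A
                   ≡ (A - 1ℚ) * (fromℕ 8 * A * A * W) * (fromℕ 8 * A * A * W) + (fromℕ 8 * A * A + A) * W * W
  expand = solve-∀ ℚ-ring

-- growth A C = 8A²((A + C) · shrink A − (A − 1 + C)) has the sign of termIncrease A C L.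
growth : ℚ → ℚ → ℚ
growth A C = fromℕ 4 * A * A - A - fromℕ 4 * A * C - C

growth-nonPos : ∀ {A C} → 0ℚ ≤ A → A ≤ C → growth A C ≤ 0ℚ
growth-nonPos {A} {C} 0≤A A≤C = ≤-by-gap (fromℕ 4 * A * (C - A) + A + C)
  (+-nonNeg (+-nonNeg (*-nonNeg (*-nonNeg (0≤fromℕ 4) 0≤A) (p≤q⇒0≤q-p A≤C)) 0≤A) (≤-trans 0≤A A≤C))
  (split A C)
  where
  split : ∀ A C → 0ℚ ≡ (fromℕ 4 * A * A - A - fromℕ 4 * A * C - C) + (fromℕ 4 * A * (C - A) + A + C)
  split = solve-∀ ℚ-ring

1≤2A-1 : ∀ {A} → 1ℚ ≤ A → 1ℚ ≤ fromℕ 2 * A - 1ℚ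
1≤2A-1 {A} 1≤A = ≤-by-gap (fromℕ 2 * (A - 1ℚ)) (*-nonNeg (0≤fromℕ 2) (p≤q⇒0≤q-p 1≤A)) (split A)
  where split : ∀ A → fromℕ 2 * A - 1ℚ ≡ 1ℚ + fromℕ 2 * (A - 1ℚ)
        split = solve-∀ ℚ-ring

1≤A-1⇒1≤A : ∀ {A} → 1ℚ ≤ A - 1ℚ → 1ℚ ≤ A
1≤A-1⇒1≤A {A} 1≤A-1 = ≤-trans 1≤A-1 (≤-by-gap 1ℚ 0≤1 (restore A))
  where restore : ∀ A → A ≡ A - 1ℚ + 1ℚ
        restore = solve-∀ ℚ-ring

0<2A[A+B][A-1] : ∀ {A B} → 1ℚ ≤ A - 1ℚ → 0ℚ ≤ B → 0ℚ < fromℕ 2 * A * (A + B) * (A - 1ℚ)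
0<2A[A+B][A-1] {A} {B} 1≤A-1 0≤B =
  *-pos (*-pos (*-pos (fromℕ-mono-< {0} {2} (ℕ.s≤s ℕ.z≤n)) 0<A) (<-≤-trans 0<A (≤-by-gap B 0≤B refl))) (<-≤-trans 0<1 1≤A-1)
  where 0<A : 0ℚ < A
        0<A = <-≤-trans 0<1 (1≤A-1⇒1≤A {A} 1≤A-1)

growth-≤ : ∀ {A C} → 1ℚ ≤ A → 1ℚ ≤ C →
           growth A C * (fromℕ 2 * A + fromℕ 2 * C - 1ℚ) ≤ fromℕ 4 * (fromℕ 2 * A - 1ℚ) * (A - 1ℚ + C) * (A + C)
growth-≤ {A} {C} 1≤A 1≤C = ≤-by-gap D 0≤D (split A C)
  where
  x = A - 1ℚ
  y = C - 1ℚ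
  0≤x = p≤q⇒0≤q-p 1≤A
  0≤y = p≤q⇒0≤q-p 1≤C
  D = fromℕ 14 + fromℕ 31 * y + fromℕ 14 * y * y + fromℕ 23 * x + fromℕ 48 * x * y + fromℕ 16 * x * y * y
      + fromℕ 10 * x * x + fromℕ 16 * x * x * y
  0≤D : 0ℚ ≤ D
  0≤D = +-nonNeg (+-nonNeg (+-nonNeg (+-nonNeg (+-nonNeg (+-nonNeg (+-nonNeg (0≤fromℕ 14)
          (*-nonNeg (0≤fromℕ 31) 0≤y)) (*-nonNeg (*-nonNeg (0≤fromℕ 14) 0≤y) 0≤y)) (*-nonNeg (0≤fromℕ 23) 0≤x))
          (*-nonNeg (*-nonNeg (0≤fromℕ 48) 0≤x) 0≤y)) (*-nonNeg (*-nonNeg (*-nonNeg (0≤fromℕ 16) 0≤x) 0≤y) 0≤y))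
          (*-nonNeg (*-nonNeg (0≤fromℕ 10) 0≤x) 0≤x)) (*-nonNeg (*-nonNeg (*-nonNeg (0≤fromℕ 16) 0≤x) 0≤x) 0≤y)
  split : ∀ A C → fromℕ 4 * (fromℕ 2 * A - 1ℚ) * (A - 1ℚ + C) * (A + C)
          ≡ (fromℕ 4 * A * A - A - fromℕ 4 * A * C - C) * (fromℕ 2 * A + fromℕ 2 * C - 1ℚ)
            + (fromℕ 14 + fromℕ 31 * (C - 1ℚ) + fromℕ 14 * (C - 1ℚ) * (C - 1ℚ) + fromℕ 23 * (A - 1ℚ)
               + fromℕ 48 * (A - 1ℚ) * (C - 1ℚ) + fromℕ 16 * (A - 1ℚ) * (C - 1ℚ) * (C - 1ℚ)
               + fromℕ 10 * (A - 1ℚ) * (A - 1ℚ) + fromℕ 16 * (A - 1ℚ) * (A - 1ℚ) * (C - 1ℚ))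
  split = solve-∀ ℚ-ring

ratios⇒≤ : ∀ {A B C} → fromℕ 2 * C * B ≤ (fromℕ 2 * A - 1ℚ) * A → fromℕ 2 * C * A ≤ (fromℕ 2 * A - 1ℚ) * B →
           fromℕ 2 * (fromℕ 2 * A - 1ℚ) * (C * ((A + B) * (A + B)))
             ≤ A * B * ((fromℕ 2 * A + fromℕ 2 * C - 1ℚ) * (fromℕ 2 * A + fromℕ 2 * C - 1ℚ))
ratios⇒≤ {A} {B} {C} 2CB≤ 2CA≤ =
  ≤-by-gap (((fromℕ 2 * A - 1ℚ) * A - fromℕ 2 * C * B) * ((fromℕ 2 * A - 1ℚ) * B - fromℕ 2 * C * A))
           (*-nonNeg (p≤q⇒0≤q-p 2CB≤) (p≤q⇒0≤q-p 2CA≤)) (split A B C)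
  where
  split : ∀ A B C → A * B * ((fromℕ 2 * A + fromℕ 2 * C - 1ℚ) * (fromℕ 2 * A + fromℕ 2 * C - 1ℚ))
          ≡ fromℕ 2 * (fromℕ 2 * A - 1ℚ) * (C * ((A + B) * (A + B)))
            + ((fromℕ 2 * A - 1ℚ) * A - fromℕ 2 * C * B) * ((fromℕ 2 * A - 1ℚ) * B - fromℕ 2 * C * A)
  split = solve-∀ ℚ-ring

-- The per-edge bound of case (ii), squared so that no square roots occur.
growth-squared-≤ : ∀ {A B C} → 1ℚ ≤ A → 0ℚ ≤ B → 1ℚ ≤ C → 0ℚ ≤ growth A C →
  fromℕ 2 * C * B ≤ (fromℕ 2 * A - 1ℚ) * A → fromℕ 2 * C * A ≤ (fromℕ 2 * A - 1ℚ) * B →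
  C * ((A + B) * (A + B)) * (growth A C * growth A C)
    ≤ fromℕ 16 * A * A * B * (((A - 1ℚ + C) * (A + C)) * ((A - 1ℚ + C) * (A + C)))
growth-squared-≤ {A} {B} {C} 1≤A 0≤B 1≤C 0≤P 2CB≤ 2CA≤ =
  *-cancelˡ-≤-pos (fromℕ 2 * (fromℕ 2 * A - 1ℚ)) {{ℚ.positive 0<2[2A-1]}} (begin
    fromℕ 2 * (fromℕ 2 * A - 1ℚ) * (C * ((A + B) * (A + B)) * (P * P))
      ≡⟨ reassoc (fromℕ 2 * (fromℕ 2 * A - 1ℚ)) (C * ((A + B) * (A + B))) (P * P) ⟩
    fromℕ 2 * (fromℕ 2 * A - 1ℚ) * (C * ((A + B) * (A + B))) * (P * P)
      ≤⟨ *-monoʳ-≤ (P * P) (0≤p*p P) (ratios⇒≤ {A} {B} {C} 2CB≤ 2CA≤) ⟩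
    A * B * (T * T) * (P * P)
      ≡⟨ regroup (A * B) T P ⟩
    A * B * ((P * T) * (P * T))
      ≤⟨ *-monoˡ-≤ (A * B) (*-nonNeg 0≤A 0≤B) (*-mono-≤ 0≤PT 0≤PT (growth-≤ {A} {C} 1≤A 1≤C) (growth-≤ {A} {C} 1≤A 1≤C)) ⟩
    A * B * (R * R)
      ≤⟨ ≤-by-gap (fromℕ 16 * A * B * (fromℕ 2 * A - 1ℚ) * ((S₁ * S₂) * (S₁ * S₂)))
                  (*-nonNeg (*-nonNeg (*-nonNeg (*-nonNeg (0≤fromℕ 16) 0≤A) 0≤B) 0≤2A-1) (0≤p*p (S₁ * S₂))) (expand A B C) ⟩
    fromℕ 2 * (fromℕ 2 * A - 1ℚ) * (fromℕ 16 * A * A * B * ((S₁ * S₂) * (S₁ * S₂)))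
      ∎)
  where
  open ≤-Reasoning
  P = growth A C
  S₁ = A - 1ℚ + C
  S₂ = A + C
  T = fromℕ 2 * A + fromℕ 2 * C - 1ℚ
  R = fromℕ 4 * (fromℕ 2 * A - 1ℚ) * S₁ * S₂
  0≤A = ≤-trans 0≤1 1≤A
  0≤2A-1 : 0ℚ ≤ fromℕ 2 * A - 1ℚ
  0≤2A-1 = ≤-trans 0≤1 (1≤2A-1 {A} 1≤A)
  0<2[2A-1] : 0ℚ < fromℕ 2 * (fromℕ 2 * A - 1ℚ)
  0<2[2A-1] = *-pos (fromℕ-mono-< {0} {2} (ℕ.s≤s ℕ.z≤n)) (<-≤-trans 0<1 (1≤2A-1 {A} 1≤A))
  0≤T : 0ℚ ≤ T
  0≤T = ≤-by-gap (fromℕ 2 * A - 1ℚ + fromℕ 2 * C) (+-nonNeg 0≤2A-1 (*-nonNeg (0≤fromℕ 2) (≤-trans 0≤1 1≤C))) (split A C)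
    where split : ∀ A C → fromℕ 2 * A + fromℕ 2 * C - 1ℚ ≡ 0ℚ + (fromℕ 2 * A - 1ℚ + fromℕ 2 * C)
          split = solve-∀ ℚ-ring
  0≤PT = *-nonNeg 0≤P 0≤T
  reassoc : ∀ k q p → k * (q * p) ≡ k * q * p
  reassoc = solve-∀ ℚ-ring
  regroup : ∀ k t p → k * (t * t) * (p * p) ≡ k * ((p * t) * (p * t))
  regroup = solve-∀ ℚ-ring
  expand : ∀ A B C → fromℕ 2 * (fromℕ 2 * A - 1ℚ) * (fromℕ 16 * A * A * B * (((A - 1ℚ + C) * (A + C)) * ((A - 1ℚ + C) * (A + C))))
           ≡ A * B * ((fromℕ 4 * (fromℕ 2 * A - 1ℚ) * (A - 1ℚ + C) * (A + C)) * (fromℕ 4 * (fromℕ 2 * A - 1ℚ) * (A - 1ℚ + C) * (A + C)))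
             + fromℕ 16 * A * B * (fromℕ 2 * A - 1ℚ) * (((A - 1ℚ + C) * (A + C)) * ((A - 1ℚ + C) * (A + C)))
  expand = solve-∀ ℚ-ring

increase-numerator-squared-≤ : ∀ {A B C L} → 1ℚ ≤ A → 0ℚ ≤ B → 1ℚ ≤ C → L * L ≤ A * C → 0ℚ ≤ growth A C →
  fromℕ 2 * C * B ≤ (fromℕ 2 * A - 1ℚ) * A → fromℕ 2 * C * A ≤ (fromℕ 2 * A - 1ℚ) * B →
  (L * growth A C * (A + B) * (A - 1ℚ)) * (L * growth A C * (A + B) * (A - 1ℚ))
    ≤ A * B * ((fromℕ 4 * A * (A - 1ℚ) * (A - 1ℚ + C) * (A + C)) * (fromℕ 4 * A * (A - 1ℚ) * (A - 1ℚ + C) * (A + C)))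
increase-numerator-squared-≤ {A} {B} {C} {L} 1≤A 0≤B 1≤C L²≤AC 0≤P 2CB≤ 2CA≤ = begin
  (L * P * (A + B) * (A - 1ℚ)) * (L * P * (A + B) * (A - 1ℚ))      ≡⟨ regroup₁ L P (A + B) (A - 1ℚ) ⟩
  L * L * (P * P * ((A + B) * (A + B)) * ((A - 1ℚ) * (A - 1ℚ)))    ≤⟨ *-monoʳ-≤ (P * P * ((A + B) * (A + B)) * ((A - 1ℚ) * (A - 1ℚ))) 0≤rest L²≤AC ⟩
  A * C * (P * P * ((A + B) * (A + B)) * ((A - 1ℚ) * (A - 1ℚ)))    ≡⟨ regroup₂ A B C P ⟩
  A * ((A - 1ℚ) * (A - 1ℚ)) * (C * ((A + B) * (A + B)) * (P * P))  ≤⟨ *-monoˡ-≤ (A * ((A - 1ℚ) * (A - 1ℚ))) (*-nonNeg (≤-trans 0≤1 1≤A) (0≤p*p (A - 1ℚ)))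
                                                                         (growth-squared-≤ {A} {B} {C} 1≤A 0≤B 1≤C 0≤P 2CB≤ 2CA≤) ⟩
  A * ((A - 1ℚ) * (A - 1ℚ)) * (fromℕ 16 * A * A * B * (((A - 1ℚ + C) * (A + C)) * ((A - 1ℚ + C) * (A + C))))
                                                                    ≡⟨ regroup₃ A B C ⟩
  A * B * ((fromℕ 4 * A * (A - 1ℚ) * (A - 1ℚ + C) * (A + C)) * (fromℕ 4 * A * (A - 1ℚ) * (A - 1ℚ + C) * (A + C))) ∎
  where
  open ≤-Reasoning
  P = growth A C
  0≤rest = *-nonNeg (*-nonNeg (0≤p*p P) (0≤p*p (A + B))) (0≤p*p (A - 1ℚ))
  regroup₁ : ∀ L P S D → L * P * S * D * (L * P * S * D) ≡ L * L * (P * P * (S * S) * (D * D))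
  regroup₁ = solve-∀ ℚ-ring
  regroup₂ : ∀ A B C P → A * C * (P * P * ((A + B) * (A + B)) * ((A - 1ℚ) * (A - 1ℚ)))
                         ≡ A * ((A - 1ℚ) * (A - 1ℚ)) * (C * ((A + B) * (A + B)) * (P * P))
  regroup₂ = solve-∀ ℚ-ring
  regroup₃ : ∀ A B C → A * ((A - 1ℚ) * (A - 1ℚ)) * (fromℕ 16 * A * A * B * (((A - 1ℚ + C) * (A + C)) * ((A - 1ℚ + C) * (A + C))))
                       ≡ A * B * ((fromℕ 4 * A * (A - 1ℚ) * (A - 1ℚ + C) * (A + C)) * (fromℕ 4 * A * (A - 1ℚ) * (A - 1ℚ + C) * (A + C)))
  regroup₃ = solve-∀ ℚ-ring

increase-numerator-≤ : ∀ {A B C L M e} → 1ℚ ≤ A - 1ℚ → 0ℚ ≤ B → 1ℚ ≤ C →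
  L * L ≤ A * C → 1ℚ ≤ M → A * B < (M + e) * (M + e) → 0ℚ ≤ e → fromℕ 2 * (A - 1ℚ) * e ≤ 1ℚ →
  fromℕ 2 * C * B ≤ (fromℕ 2 * A - 1ℚ) * A → fromℕ 2 * C * A ≤ (fromℕ 2 * A - 1ℚ) * B → 0ℚ ≤ growth A C →
  L * growth A C * (A + B) * (A - 1ℚ) ≤ M * (fromℕ 2 * A * (fromℕ 2 * A - 1ℚ) * (A - 1ℚ + C) * (A + C))
increase-numerator-≤ {A} {B} {C} {L} {M} {e} 1≤A-1 0≤B 1≤C L²≤AC 1≤M AB<[M+e]² 0≤e 2[A-1]e≤1 2CB≤ 2CA≤ 0≤P =
  <⇒≤ (<-≤-trans X<[M+e]Y [M+e]Y≤M·V)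
  where
  1≤A = 1≤A-1⇒1≤A {A} 1≤A-1
  0≤A = ≤-trans 0≤1 1≤A
  S₁ = A - 1ℚ + C
  S₂ = A + C
  0<S₁ = <-≤-trans 0<1 (+-mono-≤ (p≤q⇒0≤q-p 1≤A) 1≤C)
  0<S₂ = <-≤-trans 0<1 (+-mono-≤ 0≤A 1≤C)
  X = L * growth A C * (A + B) * (A - 1ℚ)
  Y = fromℕ 4 * A * (A - 1ℚ) * S₁ * S₂
  0<Y : 0ℚ < Y
  0<Y = *-pos (*-pos (*-pos (*-pos (fromℕ-mono-< {0} {4} (ℕ.s≤s ℕ.z≤n)) (<-≤-trans 0<1 1≤A)) (<-≤-trans 0<1 1≤A-1)) 0<S₁) 0<S₂
  X<[M+e]Y : X < (M + e) * Y
  X<[M+e]Y = p*p<q*q⇒p<q (*-nonNeg (+-nonNeg (≤-trans 0≤1 1≤M) 0≤e) (<⇒≤ 0<Y))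
    (≤-<-trans (increase-numerator-squared-≤ {A} {B} {C} {L} 1≤A 0≤B 1≤C L²≤AC 0≤P 2CB≤ 2CA≤)
      (<-≤-trans (*-monoˡ-<-pos (Y * Y) {{ℚ.positive (*-pos 0<Y 0<Y)}} AB<[M+e]²) (≤-reflexive (regroup (M + e) Y))))
    where regroup : ∀ m y → m * m * (y * y) ≡ (m * y) * (m * y)
          regroup = solve-∀ ℚ-ring
  [M+e]Y≤M·V : (M + e) * Y ≤ M * (fromℕ 2 * A * (fromℕ 2 * A - 1ℚ) * S₁ * S₂)
  [M+e]Y≤M·V = ≤-by-gap (fromℕ 2 * A * S₁ * S₂ * (M - fromℕ 2 * (A - 1ℚ) * e))
    (*-nonNeg (*-nonNeg (*-nonNeg (*-nonNeg (0≤fromℕ 2) 0≤A) (<⇒≤ 0<S₁)) (<⇒≤ 0<S₂)) (p≤q⇒0≤q-p (≤-trans 2[A-1]e≤1 1≤M)))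
    (split A C M e)
    where split : ∀ A C M e → M * (fromℕ 2 * A * (fromℕ 2 * A - 1ℚ) * (A - 1ℚ + C) * (A + C))
                  ≡ (M + e) * (fromℕ 4 * A * (A - 1ℚ) * (A - 1ℚ + C) * (A + C))
                    + fromℕ 2 * A * (A - 1ℚ + C) * (A + C) * (M - fromℕ 2 * (A - 1ℚ) * e)
          split = solve-∀ ℚ-ring

-- The increase 2L·shrink A/(A − 1 + C) − 2L/(A + C) of the term of an edge vu, with L ≈ √(d_v d_u), when
-- d_v = A drops by one and d_u = C (DegreeLoss.shrink-split).
termIncrease : ℚ → ℚ → ℚ → ℚ
termIncrease A C L = fromℕ 2 * L * growth A C * (fromℕ 8 * A * A) ⁻¹ * (A - 1ℚ + C) ⁻¹ * (A + C) ⁻¹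

-- (2A − 1)/(4A(A − 1)) times the term 2M/(A + B) of the deleted edge, so that the A − 1 other edges at
-- an endpoint of degree A may together gain (1/2 − 1/(4A)) times that term.
lossBudget : ℚ → ℚ → ℚ → ℚ
lossBudget A B M = (fromℕ 2 * A - 1ℚ) * M * (fromℕ 2 * A * (A + B) * (A - 1ℚ)) ⁻¹

module DegreeLoss {A C : ℚ} (1≤A : 1ℚ ≤ A) (1≤C : 1ℚ ≤ C) where

  W U₁ U₂ : ℚ
  W  = (fromℕ 8 * A * A) ⁻¹
  U₁ = (A - 1ℚ + C) ⁻¹
  U₂ = (A + C) ⁻¹

  private
    0≤A : 0ℚ ≤ A
    0≤A = ≤-trans 0≤1 1≤A
    1≤S₁ : 1ℚ ≤ A - 1ℚ + C
    1≤S₁ = +-mono-≤ (p≤q⇒0≤q-p 1≤A) 1≤C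
    1≤S₂ : 1ℚ ≤ A + C
    1≤S₂ = +-mono-≤ 0≤A 1≤C

  8A²W≡1 : fromℕ 8 * A * A * W ≡ 1ℚ
  8A²W≡1 = p*p⁻¹≡1 (0<8A² 1≤A)
  S₁U₁≡1 : (A - 1ℚ + C) * U₁ ≡ 1ℚ
  S₁U₁≡1 = p*p⁻¹≡1 (<-≤-trans 0<1 1≤S₁)
  S₂U₂≡1 : (A + C) * U₂ ≡ 1ℚ
  S₂U₂≡1 = p*p⁻¹≡1 (<-≤-trans 0<1 1≤S₂)

  0≤W : 0ℚ ≤ W
  0≤W = <⇒≤ (0<p⇒0<p⁻¹ (0<8A² 1≤A))
  0≤U₁ : 0ℚ ≤ U₁
  0≤U₁ = <⇒≤ (0<p⇒0<p⁻¹ (<-≤-trans 0<1 1≤S₁))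
  0≤U₂ : 0ℚ ≤ U₂
  0≤U₂ = <⇒≤ (0<p⇒0<p⁻¹ (<-≤-trans 0<1 1≤S₂))

  shrink-split : ∀ L → fromℕ 2 * L * shrink A * U₁ ≡ fromℕ 2 * L * U₂ + termIncrease A C L
  shrink-split L = begin
    fromℕ 2 * L * shrink A * U₁
      ≡⟨ sym (trans (cong (fromℕ 2 * L * shrink A * U₁ *_) S₂U₂≡1) (*-identityʳ _)) ⟩
    fromℕ 2 * L * shrink A * U₁ * ((A + C) * U₂)
      ≡⟨ expand L A C W U₁ U₂ ⟩
    fromℕ 2 * L * U₂ * (fromℕ 8 * A * A * W) * ((A - 1ℚ + C) * U₁) + fromℕ 2 * L * growth A C * W * U₁ * U₂
      ≡⟨ cong₂ (λ s t → fromℕ 2 * L * U₂ * s * t + fromℕ 2 * L * growth A C * W * U₁ * U₂) 8A²W≡1 S₁U₁≡1 ⟩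
    fromℕ 2 * L * U₂ * 1ℚ * 1ℚ + fromℕ 2 * L * growth A C * W * U₁ * U₂
      ≡⟨ cong (_+ fromℕ 2 * L * growth A C * W * U₁ * U₂) (trans (*-identityʳ _) (*-identityʳ (fromℕ 2 * L * U₂))) ⟩
    fromℕ 2 * L * U₂ + fromℕ 2 * L * growth A C * W * U₁ * U₂
      ∎
    where
    open ≡-Reasoning
    expand : ∀ L A C W U₁ U₂ →
      fromℕ 2 * L * ((fromℕ 8 * A * A - fromℕ 4 * A - 1ℚ) * W) * U₁ * ((A + C) * U₂)
      ≡ fromℕ 2 * L * U₂ * (fromℕ 8 * A * A * W) * ((A - 1ℚ + C) * U₁)
        + fromℕ 2 * L * (fromℕ 4 * A * A - A - fromℕ 4 * A * C - C) * W * U₁ * U₂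
    expand = solve-∀ ℚ-ring

  loss-≤ : ∀ {L e β} → 0ℚ ≤ L → 0ℚ ≤ e → 0ℚ ≤ β →
           (0ℚ < growth A C → termIncrease A C L ≤ β) →
           fromℕ 2 * ((L + e) * shrink A * 1ℚ) * U₁ ≤ fromℕ 2 * L * U₂ + β + fromℕ 2 * e
  loss-≤ {L} {e} {β} 0≤L 0≤e 0≤β growth⇒≤β = begin
    fromℕ 2 * ((L + e) * shrink A * 1ℚ) * U₁
      ≡⟨ distribute (fromℕ 2) L e (shrink A) U₁ ⟩
    fromℕ 2 * L * shrink A * U₁ + fromℕ 2 * e * shrink A * U₁
      ≡⟨ cong (_+ fromℕ 2 * e * shrink A * U₁) (shrink-split L) ⟩
    fromℕ 2 * L * U₂ + increase + fromℕ 2 * e * shrink A * U₁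
      ≤⟨ +-mono-≤ (+-monoʳ-≤ (fromℕ 2 * L * U₂) increase≤β) error≤ ⟩
    fromℕ 2 * L * U₂ + β + fromℕ 2 * e
      ∎
    where
    open ≤-Reasoning
    increase = termIncrease A C L
    0≤2L = *-nonNeg (0≤fromℕ 2) 0≤L
    0≤2e = *-nonNeg (0≤fromℕ 2) 0≤e
    increase≤β : increase ≤ β
    increase≤β with 0ℚ <? growth A C
    ... | yes 0<growth = growth⇒≤β 0<growth
    ... | no 0≮growth  = ≤-trans (≤-by-gap (fromℕ 2 * L * (0ℚ - growth A C) * W * U₁ * U₂)
          (*-nonNeg (*-nonNeg (*-nonNeg (*-nonNeg 0≤2L (p≤q⇒0≤q-p (≮⇒≥ 0≮growth))) 0≤W) 0≤U₁) 0≤U₂)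
          (cancel (fromℕ 2 * L) (growth A C) W U₁ U₂)) 0≤β
      where cancel : ∀ l p w u v → 0ℚ ≡ l * p * w * u * v + l * (0ℚ - p) * w * u * v
            cancel = solve-∀ ℚ-ring
    error≤ : fromℕ 2 * e * shrink A * U₁ ≤ fromℕ 2 * e
    error≤ = subst₂ _≤_ (sym (*-assoc (fromℕ 2 * e) (shrink A) U₁)) (trans (cong (fromℕ 2 * e *_) (*-identityˡ 1ℚ)) (*-identityʳ (fromℕ 2 * e)))
      (*-monoˡ-≤ (fromℕ 2 * e) 0≤2e (*-mono-≤ (shrink-nonNeg 1≤A) 0≤U₁ (shrink-≤-1 1≤A) (1≤p⇒p⁻¹≤1 1≤S₁)))
    distribute : ∀ c L e r U → c * ((L + e) * r * 1ℚ) * U ≡ c * L * r * U + c * e * r * U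
    distribute = solve-∀ ℚ-ring

  termIncrease-≤-lossBudget : ∀ {B L M e} → 1ℚ ≤ A - 1ℚ → 0ℚ ≤ B →
    0ℚ ≤ L → L * L ≤ A * C → 1ℚ ≤ M → A * B < (M + e) * (M + e) → 0ℚ ≤ e → fromℕ 2 * (A - 1ℚ) * e ≤ 1ℚ →
    fromℕ 2 * C * B ≤ (fromℕ 2 * A - 1ℚ) * A → fromℕ 2 * C * A ≤ (fromℕ 2 * A - 1ℚ) * B → 0ℚ ≤ growth A C →
    termIncrease A C L ≤ lossBudget A B M
  termIncrease-≤-lossBudget {B} {L} {M} {e} 1≤A-1 0≤B 0≤L L²≤AC 1≤M AB<[M+e]² 0≤e 2[A-1]e≤1 2CB≤ 2CA≤ 0≤P =
    subst₂ _≤_ scaled-left scaled-right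
      (*-monoʳ-≤ K 0≤K (increase-numerator-≤ {A} {B} {C} {L} {M} {e} 1≤A-1 0≤B 1≤C L²≤AC 1≤M AB<[M+e]² 0≤e 2[A-1]e≤1 2CB≤ 2CA≤ 0≤P))
    where
    P  = growth A C
    S₁ = A - 1ℚ + C
    S₂ = A + C
    0<K′ = 0<2A[A+B][A-1] {A} {B} 1≤A-1 0≤B
    V  = (fromℕ 2 * A * (A + B) * (A - 1ℚ)) ⁻¹
    K  = fromℕ 4 * A * W * U₁ * U₂ * V
    0≤K = *-nonNeg (*-nonNeg (*-nonNeg (*-nonNeg (*-nonNeg (0≤fromℕ 4) 0≤A) 0≤W) 0≤U₁) 0≤U₂) (<⇒≤ (0<p⇒0<p⁻¹ 0<K′))

    scaled-left : L * P * (A + B) * (A - 1ℚ) * K ≡ termIncrease A C L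
    scaled-left = begin
      L * P * (A + B) * (A - 1ℚ) * K                                                ≡⟨ regroup L P A B W U₁ U₂ V ⟩
      fromℕ 2 * L * P * W * U₁ * U₂ * (fromℕ 2 * A * (A + B) * (A - 1ℚ) * V)       ≡⟨ cong (fromℕ 2 * L * P * W * U₁ * U₂ *_) (p*p⁻¹≡1 0<K′) ⟩
      fromℕ 2 * L * P * W * U₁ * U₂ * 1ℚ                                           ≡⟨ *-identityʳ _ ⟩
      fromℕ 2 * L * P * W * U₁ * U₂                                                ∎
      where
      open ≡-Reasoning
      regroup : ∀ L P A B W U₁ U₂ V → L * P * (A + B) * (A - 1ℚ) * (fromℕ 4 * A * W * U₁ * U₂ * V)
                ≡ fromℕ 2 * L * P * W * U₁ * U₂ * (fromℕ 2 * A * (A + B) * (A - 1ℚ) * V)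
      regroup = solve-∀ ℚ-ring

    scaled-right : M * (fromℕ 2 * A * (fromℕ 2 * A - 1ℚ) * S₁ * S₂) * K ≡ lossBudget A B M
    scaled-right = begin
      M * (fromℕ 2 * A * (fromℕ 2 * A - 1ℚ) * S₁ * S₂) * K                          ≡⟨ regroup M A C W U₁ U₂ V ⟩
      (fromℕ 2 * A - 1ℚ) * M * V * (fromℕ 8 * A * A * W) * (S₁ * U₁) * (S₂ * U₂)  ≡⟨ cong₂ (λ s t → (fromℕ 2 * A - 1ℚ) * M * V * s * t * (S₂ * U₂)) 8A²W≡1 S₁U₁≡1 ⟩
      (fromℕ 2 * A - 1ℚ) * M * V * 1ℚ * 1ℚ * (S₂ * U₂)                            ≡⟨ cong ((fromℕ 2 * A - 1ℚ) * M * V * 1ℚ * 1ℚ *_) S₂U₂≡1 ⟩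
      (fromℕ 2 * A - 1ℚ) * M * V * 1ℚ * 1ℚ * 1ℚ                                   ≡⟨ drop-ones ((fromℕ 2 * A - 1ℚ) * M * V) ⟩
      lossBudget A B M                                                              ∎
      where
      open ≡-Reasoning
      regroup : ∀ M A C W U₁ U₂ V → M * (fromℕ 2 * A * (fromℕ 2 * A - 1ℚ) * (A - 1ℚ + C) * (A + C)) * (fromℕ 4 * A * W * U₁ * U₂ * V)
                ≡ (fromℕ 2 * A - 1ℚ) * M * V * (fromℕ 8 * A * A * W) * ((A - 1ℚ + C) * U₁) * ((A + C) * U₂)
      regroup = solve-∀ ℚ-ring
      drop-ones : ∀ x → x * 1ℚ * 1ℚ * 1ℚ ≡ x
      drop-ones = solve-∀ ℚ-ring

lossBudget-nonNeg : ∀ {A B M} → 1ℚ ≤ A - 1ℚ → 0ℚ ≤ B → 0ℚ ≤ M → 0ℚ ≤ lossBudget A B M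
lossBudget-nonNeg {A} {B} {M} 1≤A-1 0≤B 0≤M =
  *-nonNeg (*-nonNeg (≤-trans 0≤1 (1≤2A-1 {A} (1≤A-1⇒1≤A {A} 1≤A-1))) 0≤M) (<⇒≤ (0<p⇒0<p⁻¹ (0<2A[A+B][A-1] {A} {B} 1≤A-1 0≤B)))

lossBudgets-< : ∀ {A B M E} → 1ℚ ≤ A - 1ℚ → 1ℚ ≤ B - 1ℚ → fromℕ 2 * A * B * E < M →
  (A - 1ℚ) * lossBudget A B M + (B - 1ℚ) * lossBudget B A M + E < (fromℕ 2 * M) ÷ (A + B)
lossBudgets-< {A} {B} {M} {E} 1≤A-1 1≤B-1 2ABE<M = p*q<r⇒p<r÷q 0<A+B (*-cancelʳ-<-nonNeg K {{ℚ.nonNegative (<⇒≤ 0<K)}} (begin-strict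
  ((A - 1ℚ) * lossBudget A B M + (B - 1ℚ) * lossBudget B A M + E) * (A + B) * K
    ≡⟨ expandˡ A B M E Vᵢ Vⱼ ⟩
  (fromℕ 2 * A - 1ℚ) * M * B * (Kᵢ * Vᵢ) + (fromℕ 2 * B - 1ℚ) * M * A * (Kⱼ * Vⱼ) + fromℕ 2 * A * B * E * (A + B)
    ≡⟨ cong₂ (λ s t → (fromℕ 2 * A - 1ℚ) * M * B * s + (fromℕ 2 * B - 1ℚ) * M * A * t + fromℕ 2 * A * B * E * (A + B)) (p*p⁻¹≡1 0<Kᵢ) (p*p⁻¹≡1 0<Kⱼ) ⟩
  (fromℕ 2 * A - 1ℚ) * M * B * 1ℚ + (fromℕ 2 * B - 1ℚ) * M * A * 1ℚ + fromℕ 2 * A * B * E * (A + B)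
    <⟨ +-monoʳ-< ((fromℕ 2 * A - 1ℚ) * M * B * 1ℚ + (fromℕ 2 * B - 1ℚ) * M * A * 1ℚ) (*-monoˡ-<-pos (A + B) {{ℚ.positive 0<A+B}} 2ABE<M) ⟩
  (fromℕ 2 * A - 1ℚ) * M * B * 1ℚ + (fromℕ 2 * B - 1ℚ) * M * A * 1ℚ + M * (A + B)
    ≡⟨ expandʳ A B M ⟩
  fromℕ 2 * M * K
    ∎))
  where
  open ≤-Reasoning
  0<A : 0ℚ < A
  0<A = <-≤-trans 0<1 (1≤A-1⇒1≤A {A} 1≤A-1)
  0<B : 0ℚ < B
  0<B = <-≤-trans 0<1 (1≤A-1⇒1≤A {B} 1≤B-1)
  0<A+B = +-mono-< 0<A 0<B
  K  = fromℕ 2 * A * B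
  0<K = *-pos (*-pos (fromℕ-mono-< {0} {2} (ℕ.s≤s ℕ.z≤n)) 0<A) 0<B
  Kᵢ = fromℕ 2 * A * (A + B) * (A - 1ℚ)
  Kⱼ = fromℕ 2 * B * (B + A) * (B - 1ℚ)
  Vᵢ = Kᵢ ⁻¹
  Vⱼ = Kⱼ ⁻¹
  0<Kᵢ = 0<2A[A+B][A-1] {A} {B} 1≤A-1 (<⇒≤ 0<B)
  0<Kⱼ = 0<2A[A+B][A-1] {B} {A} 1≤B-1 (<⇒≤ 0<A)
  expandˡ : ∀ A B M E Vᵢ Vⱼ →
    ((A - 1ℚ) * ((fromℕ 2 * A - 1ℚ) * M * Vᵢ) + (B - 1ℚ) * ((fromℕ 2 * B - 1ℚ) * M * Vⱼ) + E) * (A + B) * (fromℕ 2 * A * B)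
    ≡ (fromℕ 2 * A - 1ℚ) * M * B * (fromℕ 2 * A * (A + B) * (A - 1ℚ) * Vᵢ) + (fromℕ 2 * B - 1ℚ) * M * A * (fromℕ 2 * B * (B + A) * (B - 1ℚ) * Vⱼ)
      + fromℕ 2 * A * B * E * (A + B)
  expandˡ = solve-∀ ℚ-ring
  expandʳ : ∀ A B M → (fromℕ 2 * A - 1ℚ) * M * B * 1ℚ + (fromℕ 2 * B - 1ℚ) * M * A * 1ℚ + M * (A + B)
                      ≡ fromℕ 2 * M * (fromℕ 2 * A * B)
  expandʳ = solve-∀ ℚ-ring

-- Comparing GA(G) with GA(G − e)

module CompareGA {n} (G : Adj n) (G-sym : symmetric G) (G-loopless : loopless G)
                (i j : Fin n) (Gij : G i j ≡ true) where

  open EdgeDeletion G G-sym G-loopless i j Gij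

  -- Case analysis on vertices passes this view as an argument; a with-abstraction would normalise the
  -- ℚ-valued goal, which is prohibitively expensive.
  data Vertex : Fin n → Set where
    at-i  : Vertex i
    at-j  : Vertex j
    other : ∀ {x} → x ≢ i → x ≢ j → Vertex x

  vertex : ∀ x → Vertex x
  vertex x with x ≟ i | x ≟ j
  ... | yes refl | _        = at-i
  ... | no _     | yes refl = at-j
  ... | no x≢i   | no x≢j   = other x≢i x≢j

  atEnds : ℚ → ℚ → ℚ → Fin n → ℚ
  atEnds p q r x = if ⌊ x ≟ i ⌋ then p else if ⌊ x ≟ j ⌋ then q else r

  atEnds-i : ∀ p q r → atEnds p q r i ≡ p
  atEnds-i _ _ _ rewrite ⌊⌋-true (i ≟ i) refl = refl

  atEnds-j : ∀ p q r → atEnds p q r j ≡ q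
  atEnds-j _ _ _ rewrite ⌊⌋-false (j ≟ i) (i≢j ∘ sym) | ⌊⌋-true (j ≟ j) refl = refl

  atEnds-other : ∀ p q r {x} → x ≢ i → x ≢ j → atEnds p q r x ≡ r
  atEnds-other _ _ _ {x} x≢i x≢j rewrite ⌊⌋-false (x ≟ i) x≢i | ⌊⌋-false (x ≟ j) x≢j = refl

  D DH : Fin n → ℚ
  D x  = fromℕ (deg G x)
  DH x = fromℕ (deg H x)

  X : ℚ
  X = fromℕ n

  1≤Dᵢ : 1ℚ ≤ D i
  1≤Dᵢ = 1≤deg G Gij

  1≤Dⱼ : 1ℚ ≤ D j
  1≤Dⱼ = 1≤deg G Gji

  N : ℕ
  N = suc (2 ℕ.* (n ℕ.* n ℕ.* n ℕ.* n))

  open LowerSqrt N (ℕ.s≤s ℕ.z≤n)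

  σ : Fin n → ℚ
  σ = atEnds (shrink (D i)) (shrink (D j)) 1ℚ

  σ-i : σ i ≡ shrink (D i)
  σ-i = atEnds-i (shrink (D i)) (shrink (D j)) 1ℚ

  σ-j : σ j ≡ shrink (D j)
  σ-j = atEnds-j (shrink (D i)) (shrink (D j)) 1ℚ

  σ-other : ∀ {x} → x ≢ i → x ≢ j → σ x ≡ 1ℚ
  σ-other = atEnds-other (shrink (D i)) (shrink (D j)) 1ℚ

  σ-nonNeg : ∀ {x} → Vertex x → 0ℚ ≤ σ x
  σ-nonNeg at-i = subst (0ℚ ≤_) (sym σ-i) (shrink-nonNeg 1≤Dᵢ)
  σ-nonNeg at-j = subst (0ℚ ≤_) (sym σ-j) (shrink-nonNeg 1≤Dⱼ)
  σ-nonNeg (other x≢i x≢j) = subst (0ℚ ≤_) (sym (σ-other x≢i x≢j)) 0≤1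

  DH≤σ²D : ∀ {x} → Vertex x → DH x ≤ σ x * σ x * D x
  DH≤σ²D at-i = subst₂ _≤_ (sym deg-deleteEdge-i) (cong (λ s → s * s * D i) (sym σ-i)) (shrink-square 1≤Dᵢ)
  DH≤σ²D at-j = subst₂ _≤_ (sym deg-deleteEdge-j) (cong (λ s → s * s * D j) (sym σ-j)) (shrink-square 1≤Dⱼ)
  DH≤σ²D {x} (other x≢i x≢j) = subst₂ _≤_ (sym (deg-deleteEdge-other x≢i x≢j)) (cong (λ s → s * s * D x) (sym (σ-other x≢i x≢j)))
          (≤-reflexive (sym (trans (cong (_* D x) (*-identityˡ 1ℚ)) (*-identityˡ (D x)))))

  qL qU : Fin n → Fin n → ℚ
  qL x y = √⁻ (deg G x ℕ.* deg G y)
  qU x y = (qL x y + ε) * σ x * σ y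

  qL-lower : LowerSqrts G qL
  qL-lower x y _ = √⁻-nonNeg (deg G x ℕ.* deg G y) , √⁻-square-≤ (deg G x ℕ.* deg G y)

  qU-upper : UpperSqrts H qU
  qU-upper x y _ = 0≤qU , (begin
    fromℕ (deg H x ℕ.* deg H y)                  ≡⟨ fromℕ-* (deg H x) (deg H y) ⟩
    DH x * DH y                                  ≤⟨ *-mono-≤ (0≤fromℕ (deg H x)) (0≤fromℕ (deg H y)) (DH≤σ²D (vertex x)) (DH≤σ²D (vertex y)) ⟩
    σ x * σ x * D x * (σ y * σ y * D y)          ≡⟨ regroup (σ x) (σ y) (D x) (D y) ⟩
    (σ x * σ y) * (σ x * σ y) * (D x * D y)      ≤⟨ *-monoˡ-≤ ((σ x * σ y) * (σ x * σ y)) (0≤p*p (σ x * σ y)) Dx·Dy≤[L+ε]² ⟩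
    (σ x * σ y) * (σ x * σ y) * ((L + ε) * (L + ε)) ≡⟨ regroup′ (σ x) (σ y) (L + ε) ⟩
    qU x y * qU x y                              ∎)
    where
    open ≤-Reasoning
    L = qL x y
    0≤qU = *-nonNeg (*-nonNeg (+-nonNeg (√⁻-nonNeg (deg G x ℕ.* deg G y)) (<⇒≤ 0<ε)) (σ-nonNeg (vertex x))) (σ-nonNeg (vertex y))
    Dx·Dy≤[L+ε]² : D x * D y ≤ (L + ε) * (L + ε)
    Dx·Dy≤[L+ε]² = subst (_≤ (L + ε) * (L + ε)) (fromℕ-* (deg G x) (deg G y)) (<⇒≤ (<-√⁻+ε-square (deg G x ℕ.* deg G y)))
    regroup : ∀ s t a b → s * s * a * (t * t * b) ≡ (s * t) * (s * t) * (a * b)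
    regroup = solve-∀ ℚ-ring
    regroup′ : ∀ s t l → (s * t) * (s * t) * (l * l) ≡ l * s * t * (l * s * t)
    regroup′ = solve-∀ ℚ-ring

  wG wH : Fin n → Fin n → ℚ
  wG x y = (fromℕ 2 * qL x y) ÷ fromℕ (deg G x ℕ.+ deg G y)
  wH x y = (fromℕ 2 * qU x y) ÷ fromℕ (deg H x ℕ.+ deg H y)

  qL-sym : ∀ x y → qL x y ≡ qL y x
  qL-sym x y = cong √⁻ (ℕ.*-comm (deg G x) (deg G y))

  wG-sym : ∀ x y → wG x y ≡ wG y x
  wG-sym x y = cong₂ (λ q d → (fromℕ 2 * q) ÷ fromℕ d) (qL-sym x y) (ℕ.+-comm (deg G x) (deg G y))

  wH-sym : ∀ x y → wH x y ≡ wH y x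
  wH-sym x y = cong₂ (λ q d → (fromℕ 2 * q) ÷ fromℕ d) qU-sym (ℕ.+-comm (deg H x) (deg H y))
    where
    swap : ∀ l s t → l * s * t ≡ l * t * s
    swap = solve-∀ ℚ-ring
    qU-sym : qU x y ≡ qU y x
    qU-sym = trans (cong (λ l → (l + ε) * σ x * σ y) (qL-sym x y)) (swap (qL y x + ε) (σ x) (σ y))

  GAwith-G : GAwith G qL ≡ edgeSum G wG
  GAwith-G = sumℚ-edges G _

  GAwith-H : GAwith H qU ≡ edgeSum H wH
  GAwith-H = sumℚ-edges H _

  wG≡ : ∀ x y → wG x y ≡ fromℕ 2 * qL x y * (D x + D y) ⁻¹
  wG≡ x y = trans (÷≡*⁻¹ (fromℕ 2 * qL x y) (fromℕ (deg G x ℕ.+ deg G y)))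
                  (cong (λ s → fromℕ 2 * qL x y * s ⁻¹) (fromℕ-+ (deg G x) (deg G y)))

  wH≡ : ∀ x y → wH x y ≡ fromℕ 2 * qU x y * (DH x + DH y) ⁻¹
  wH≡ x y = trans (÷≡*⁻¹ (fromℕ 2 * qU x y) (fromℕ (deg H x ℕ.+ deg H y)))
                  (cong (λ s → fromℕ 2 * qU x y * s ⁻¹) (fromℕ-+ (deg H x) (deg H y)))

  inner-edge-≤ : ∀ {x y} → x ≢ i → x ≢ j → y ≢ i → y ≢ j → G x y ≡ true → wH x y ≤ wG x y + fromℕ 2 * ε
  inner-edge-≤ {x} {y} x≢i x≢j y≢i y≢j Gxy = begin
    wH x y                                     ≡⟨ wH≡ x y ⟩
    fromℕ 2 * ((L + ε) * σ x * σ y) * (DH x + DH y) ⁻¹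
                                               ≡⟨ cong₂ (λ s S → fromℕ 2 * s * S ⁻¹) (cong₂ (λ s t → (L + ε) * s * t) (σ-other x≢i x≢j) (σ-other y≢i y≢j))
                                                        (cong₂ _+_ (deg-deleteEdge-other x≢i x≢j) (deg-deleteEdge-other y≢i y≢j)) ⟩
    fromℕ 2 * ((L + ε) * 1ℚ * 1ℚ) * S ⁻¹      ≡⟨ distribute (fromℕ 2) L ε (S ⁻¹) ⟩
    fromℕ 2 * L * S ⁻¹ + fromℕ 2 * ε * S ⁻¹    ≤⟨ +-mono-≤ (≤-reflexive (sym (wG≡ x y))) 2εS⁻¹≤2ε ⟩
    wG x y + fromℕ 2 * ε                       ∎
    where
    open ≤-Reasoning
    L = qL x y
    S = D x + D y
    1≤S : 1ℚ ≤ S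
    1≤S = subst (_≤ S) (+-identityʳ 1ℚ) (+-mono-≤ (1≤deg G Gxy) (0≤fromℕ (deg G y)))
    2εS⁻¹≤2ε : fromℕ 2 * ε * S ⁻¹ ≤ fromℕ 2 * ε
    2εS⁻¹≤2ε = subst (fromℕ 2 * ε * S ⁻¹ ≤_) (*-identityʳ (fromℕ 2 * ε))
      (*-monoˡ-≤ (fromℕ 2 * ε) (*-nonNeg (0≤fromℕ 2) (<⇒≤ 0<ε)) (1≤p⇒p⁻¹≤1 1≤S))
    distribute : ∀ c l e u → c * ((l + e) * 1ℚ * 1ℚ) * u ≡ c * l * u + c * e * u
    distribute = solve-∀ ℚ-ring

  endpoint-≤ : ∀ {v u β} → σ v ≡ shrink (D v) → DH v ≡ D v - 1ℚ → u ≢ i → u ≢ j → G v u ≡ true → 0ℚ ≤ β →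
               (0ℚ < growth (D v) (D u) → termIncrease (D v) (D u) (qL v u) ≤ β) →
               wH v u ≤ wG v u + β + fromℕ 2 * ε
  endpoint-≤ {v} {u} {β} σv DHv u≢i u≢j Gvu 0≤β increase≤β = begin
    wH v u                                                          ≡⟨ wH≡ v u ⟩
    fromℕ 2 * ((L + ε) * σ v * σ u) * (DH v + DH u) ⁻¹              ≡⟨ cong₂ (λ s S → fromℕ 2 * s * S ⁻¹)
                                                                         (cong₂ (λ s t → (L + ε) * s * t) σv (σ-other u≢i u≢j))
                                                                         (cong₂ _+_ DHv (deg-deleteEdge-other u≢i u≢j)) ⟩
    fromℕ 2 * ((L + ε) * shrink (D v) * 1ℚ) * (D v - 1ℚ + D u) ⁻¹   ≤⟨ Loss.loss-≤ (√⁻-nonNeg (deg G v ℕ.* deg G u)) (<⇒≤ 0<ε) 0≤β increase≤β ⟩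
    fromℕ 2 * L * (D v + D u) ⁻¹ + β + fromℕ 2 * ε                  ≡⟨ cong (λ w → w + β + fromℕ 2 * ε) (sym (wG≡ v u)) ⟩
    wG v u + β + fromℕ 2 * ε                                        ∎
    where
    open ≤-Reasoning
    L = qL v u
    module Loss = DegreeLoss (1≤deg G Gvu) (1≤deg G (trans (G-sym u v) Gvu))

  EndpointBound : Fin n → ℚ → Set
  EndpointBound v β = ∀ {u} → u ≢ i → u ≢ j → G v u ≡ true → wH v u ≤ wG v u + β + fromℕ 2 * ε

  budget : ℚ → ℚ → Fin n → ℚ
  budget βᵢ βⱼ x = (if ⌊ x ≟ i ⌋ then βᵢ else 0ℚ) + (if ⌊ x ≟ j ⌋ then βⱼ else 0ℚ) + ε

  budget-i : ∀ βᵢ βⱼ → budget βᵢ βⱼ i ≡ βᵢ + 0ℚ + ε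
  budget-i βᵢ βⱼ = cong₂ (λ a b → (if a then βᵢ else 0ℚ) + (if b then βⱼ else 0ℚ) + ε) (⌊⌋-true (i ≟ i) refl) (⌊⌋-false (i ≟ j) i≢j)

  budget-j : ∀ βᵢ βⱼ → budget βᵢ βⱼ j ≡ 0ℚ + βⱼ + ε
  budget-j βᵢ βⱼ = cong₂ (λ a b → (if a then βᵢ else 0ℚ) + (if b then βⱼ else 0ℚ) + ε) (⌊⌋-false (j ≟ i) (i≢j ∘ sym)) (⌊⌋-true (j ≟ j) refl)

  budget-other : ∀ βᵢ βⱼ {x} → x ≢ i → x ≢ j → budget βᵢ βⱼ x ≡ 0ℚ + 0ℚ + ε
  budget-other βᵢ βⱼ {x} x≢i x≢j = cong₂ (λ a b → (if a then βᵢ else 0ℚ) + (if b then βⱼ else 0ℚ) + ε) (⌊⌋-false (x ≟ i) x≢i) (⌊⌋-false (x ≟ j) x≢j)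

  edge-≤ : ∀ {βᵢ βⱼ} → EndpointBound i βᵢ → EndpointBound j βⱼ →
           ∀ x y → H x y ≡ true → wH x y ≤ wG x y + (budget βᵢ βⱼ x + budget βᵢ βⱼ y)
  edge-≤ {βᵢ} {βⱼ} bound-i bound-j x y = by-cases (vertex x) (vertex y)
    where
    b = budget βᵢ βⱼ
    absurd : ∀ {x y} → H x y ≡ false → H x y ≡ true → wH x y ≤ wG x y + (b x + b y)
    absurd Hxy≡false Hxy = contradiction (trans (sym Hxy≡false) Hxy) λ ()
    at-end : ∀ {v u} βᵥ → b v ≡ βᵥ + ε → b u ≡ 0ℚ + 0ℚ + ε → wH v u ≤ wG v u + βᵥ + fromℕ 2 * ε →
             wH v u ≤ wG v u + (b v + b u)
    at-end {v} {u} βᵥ bv bu wHvu≤ = subst (wH v u ≤_) (trans (regroup (wG v u) βᵥ ε) (cong₂ (λ s t → wG v u + (s + t)) (sym bv) (sym bu))) wHvu≤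
      where regroup : ∀ w β e → w + β + fromℕ 2 * e ≡ w + ((β + e) + (0ℚ + 0ℚ + e))
            regroup = solve-∀ ℚ-ring
    flipped : ∀ {x y} → wH y x ≤ wG y x + (b y + b x) → wH x y ≤ wG x y + (b x + b y)
    flipped {x} {y} ≤yx = subst₂ _≤_ (wH-sym y x) (cong₂ _+_ (wG-sym y x) (+-comm (b y) (b x))) ≤yx
    βᵢ+ε : b i ≡ βᵢ + ε
    βᵢ+ε = trans (budget-i βᵢ βⱼ) (cong (_+ ε) (+-identityʳ βᵢ))
    βⱼ+ε : b j ≡ βⱼ + ε
    βⱼ+ε = trans (budget-j βᵢ βⱼ) (cong (_+ ε) (+-identityˡ βⱼ))
    by-cases : ∀ {x y} → Vertex x → Vertex y → H x y ≡ true → wH x y ≤ wG x y + (b x + b y)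
    by-cases at-i at-i = absurd (H-loopless i)
    by-cases at-i at-j = absurd H-ij
    by-cases at-j at-i = absurd H-ji
    by-cases at-j at-j = absurd (H-loopless j)
    by-cases at-i (other u≢i u≢j) Hiu = at-end βᵢ βᵢ+ε (budget-other βᵢ βⱼ u≢i u≢j) (bound-i u≢i u≢j (H⊆G Hiu))
    by-cases at-j (other u≢i u≢j) Hju = at-end βⱼ βⱼ+ε (budget-other βᵢ βⱼ u≢i u≢j) (bound-j u≢i u≢j (H⊆G Hju))
    by-cases (other u≢i u≢j) at-i Hui = flipped (at-end βᵢ βᵢ+ε (budget-other βᵢ βⱼ u≢i u≢j) (bound-i u≢i u≢j (H⊆G (trans (H-sym i _) Hui))))
    by-cases (other u≢i u≢j) at-j Huj = flipped (at-end βⱼ βⱼ+ε (budget-other βᵢ βⱼ u≢i u≢j) (bound-j u≢i u≢j (H⊆G (trans (H-sym j _) Huj))))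
    by-cases {x} {y} (other x≢i x≢j) (other y≢i y≢j) Hxy =
      subst (wH x y ≤_) (cong (wG x y +_) (trans (double ε) (sym (cong₂ _+_ (budget-other βᵢ βⱼ x≢i x≢j) (budget-other βᵢ βⱼ y≢i y≢j)))))
        (inner-edge-≤ x≢i x≢j y≢i y≢j (H⊆G Hxy))
      where double : ∀ e → fromℕ 2 * e ≡ (0ℚ + 0ℚ + e) + (0ℚ + 0ℚ + e)
            double = solve-∀ ℚ-ring

  budget-total : ∀ βᵢ βⱼ → ∑[ x < n ] (DH x * budget βᵢ βⱼ x) ≤ (D i - 1ℚ) * βᵢ + (D j - 1ℚ) * βⱼ + X * X * ε
  budget-total βᵢ βⱼ = begin
    ∑[ x < n ] (DH x * budget βᵢ βⱼ x)
      ≡⟨ sum-cong-≗ (λ x → distribute (DH x) ⌊ x ≟ i ⌋ ⌊ x ≟ j ⌋) ⟩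
    ∑[ x < n ] ((if ⌊ x ≟ i ⌋ then DH x * βᵢ else 0ℚ) + (if ⌊ x ≟ j ⌋ then DH x * βⱼ else 0ℚ) + DH x * ε)
      ≡⟨ ∑-distrib-+ (λ x → (if ⌊ x ≟ i ⌋ then DH x * βᵢ else 0ℚ) + (if ⌊ x ≟ j ⌋ then DH x * βⱼ else 0ℚ)) (λ x → DH x * ε) ⟩
    ∑[ x < n ] ((if ⌊ x ≟ i ⌋ then DH x * βᵢ else 0ℚ) + (if ⌊ x ≟ j ⌋ then DH x * βⱼ else 0ℚ)) + ∑[ x < n ] (DH x * ε)
      ≡⟨ cong (_+ ∑[ x < n ] (DH x * ε)) (trans (∑-distrib-+ (λ x → if ⌊ x ≟ i ⌋ then DH x * βᵢ else 0ℚ) _)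
                                                (cong₂ _+_ (∑-pointMass i (λ x → DH x * βᵢ)) (∑-pointMass j (λ x → DH x * βⱼ)))) ⟩
    DH i * βᵢ + DH j * βⱼ + ∑[ x < n ] (DH x * ε)
      ≤⟨ +-mono-≤ (≤-reflexive (cong₂ (λ s t → s * βᵢ + t * βⱼ) deg-deleteEdge-i deg-deleteEdge-j)) degrees≤ ⟩
    (D i - 1ℚ) * βᵢ + (D j - 1ℚ) * βⱼ + X * X * ε
      ∎
    where
    open ≤-Reasoning
    expand : ∀ c p q e → c * (p + q + e) ≡ c * p + c * q + c * e
    expand = solve-∀ ℚ-ring
    distribute : ∀ c a b → c * ((if a then βᵢ else 0ℚ) + (if b then βⱼ else 0ℚ) + ε)
                           ≡ (if a then c * βᵢ else 0ℚ) + (if b then c * βⱼ else 0ℚ) + c * ε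
    distribute c true  true  = expand c βᵢ βⱼ ε
    distribute c true  false = trans (expand c βᵢ 0ℚ ε) (cong (λ t → c * βᵢ + t + c * ε) (*-zeroʳ c))
    distribute c false true  = trans (expand c 0ℚ βⱼ ε) (cong (λ t → t + c * βⱼ + c * ε) (*-zeroʳ c))
    distribute c false false = trans (expand c 0ℚ 0ℚ ε) (cong₂ (λ s t → s + t + c * ε) (*-zeroʳ c) (*-zeroʳ c))

    degrees≤ : ∑[ x < n ] (DH x * ε) ≤ X * X * ε
    degrees≤ = begin
      ∑[ x < n ] (DH x * ε)   ≤⟨ ∑-mono-≤ (λ x → *-monoʳ-≤ ε (<⇒≤ 0<ε) (deg≤n H x)) ⟩
      ∑[ x < n ] (X * ε)      ≡⟨ ∑-const n (X * ε) ⟩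
      X * (X * ε)             ≡⟨ sym (*-assoc X X ε) ⟩
      X * X * ε               ∎

  GA>-of-endpointBounds : ∀ {βᵢ βⱼ} → EndpointBound i βᵢ → EndpointBound j βⱼ →
                          (D i - 1ℚ) * βᵢ + (D j - 1ℚ) * βⱼ + X * X * ε < wG i j → GA> G H
  GA>-of-endpointBounds {βᵢ} {βⱼ} bound-i bound-j small =
    qL , qU , qL-lower , qU-upper ,
    subst₂ _<_ (sym GAwith-H) (sym GAwith-G)
      (edgeSum-deleteEdge-< wG wH (budget βᵢ βⱼ) wG-sym wH-sym (edge-≤ bound-i bound-j)
        (≤-<-trans (budget-total βᵢ βⱼ) small))

  M : ℚ
  M = qL i j

  1≤M : 1ℚ ≤ M
  1≤M = 1≤√⁻ (deg G i ℕ.* deg G j) (ℕ.*-mono-≤ (fromℕ-cancel-≤ {1} {deg G i} 1≤Dᵢ) (fromℕ-cancel-≤ {1} {deg G j} 1≤Dⱼ))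

  DᵢDⱼ<[M+ε]² : D i * D j < (M + ε) * (M + ε)
  DᵢDⱼ<[M+ε]² = subst (_< (M + ε) * (M + ε)) (fromℕ-* (deg G i) (deg G j)) (<-√⁻+ε-square (deg G i ℕ.* deg G j))

  wGᵢⱼ≡ : wG i j ≡ (fromℕ 2 * M) ÷ (D i + D j)
  wGᵢⱼ≡ = cong ((fromℕ 2 * M) ÷_) (fromℕ-+ (deg G i) (deg G j))

  1≤X : 1ℚ ≤ X
  1≤X = ≤-trans 1≤Dᵢ (deg≤n G i)

  0≤X : 0ℚ ≤ X
  0≤X = ≤-trans 0≤1 1≤X

  X≤X⁴ : X ≤ X * X * X * X
  X≤X⁴ = ≤-trans (grow X 0≤X) (≤-trans (grow (X * X) (*-nonNeg 0≤X 0≤X)) (grow (X * X * X) (*-nonNeg (*-nonNeg 0≤X 0≤X) 0≤X)))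
    where grow : ∀ p → 0ℚ ≤ p → p ≤ p * X
          grow p 0≤p = subst (_≤ p * X) (*-identityʳ p) (*-monoˡ-≤ p 0≤p 1≤X)

  2X⁴ε<1 : fromℕ 2 * (X * X * X * X) * ε < 1ℚ
  2X⁴ε<1 = <-by-gap ε 0<ε (begin
    1ℚ                                            ≡⟨ sym N*ε≡1 ⟩
    fromℕ N * ε                                   ≡⟨ cong (_* ε) fromℕ-N ⟩
    (fromℕ 2 * (X * X * X * X) + 1ℚ) * ε          ≡⟨ trans (*-distribʳ-+ ε (fromℕ 2 * (X * X * X * X)) 1ℚ) (cong (fromℕ 2 * (X * X * X * X) * ε +_) (*-identityˡ ε)) ⟩
    fromℕ 2 * (X * X * X * X) * ε + ε             ∎)
    where
    open ≡-Reasoning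
    fromℕ-N : fromℕ N ≡ fromℕ 2 * (X * X * X * X) + 1ℚ
    fromℕ-N = trans (fromℕ-suc (2 ℕ.* (n ℕ.* n ℕ.* n ℕ.* n))) (cong (_+ 1ℚ)
      (trans (fromℕ-* 2 (n ℕ.* n ℕ.* n ℕ.* n)) (cong (fromℕ 2 *_)
        (trans (fromℕ-* (n ℕ.* n ℕ.* n) n) (cong (_* X) (trans (fromℕ-* (n ℕ.* n) n) (cong (_* X) (fromℕ-* n n))))))))

  2DᵢDⱼXXε<1 : fromℕ 2 * D i * D j * (X * X * ε) < 1ℚ
  2DᵢDⱼXXε<1 = ≤-<-trans (begin
    fromℕ 2 * D i * D j * (X * X * ε)        ≡⟨ regroup (D i) (D j) X ε ⟩
    fromℕ 2 * ε * (D i * D j * (X * X))     ≤⟨ *-monoˡ-≤ (fromℕ 2 * ε) (*-nonNeg (0≤fromℕ 2) (<⇒≤ 0<ε))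
                                                 (*-monoʳ-≤ (X * X) (*-nonNeg 0≤X 0≤X)
                                                   (*-mono-≤ (0≤fromℕ (deg G i)) (0≤fromℕ (deg G j)) (deg≤n G i) (deg≤n G j))) ⟩
    fromℕ 2 * ε * (X * X * (X * X))         ≡⟨ regroup′ X ε ⟩
    fromℕ 2 * (X * X * X * X) * ε           ∎) 2X⁴ε<1
    where
    open ≤-Reasoning
    regroup : ∀ a b x e → fromℕ 2 * a * b * (x * x * e) ≡ fromℕ 2 * e * (a * b * (x * x))
    regroup = solve-∀ ℚ-ring
    regroup′ : ∀ x e → fromℕ 2 * e * (x * x * (x * x)) ≡ fromℕ 2 * (x * x * x * x) * e
    regroup′ = solve-∀ ℚ-ring

  2[D-1]ε≤1 : ∀ v → fromℕ 2 * (D v - 1ℚ) * ε ≤ 1ℚ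
  2[D-1]ε≤1 v = <⇒≤ (≤-<-trans (*-monoʳ-≤ ε (<⇒≤ 0<ε) (*-monoˡ-≤ (fromℕ 2) (0≤fromℕ 2) Dᵥ-1≤X⁴)) 2X⁴ε<1)
    where
    restore : ∀ d → d ≡ d - 1ℚ + 1ℚ
    restore = solve-∀ ℚ-ring
    Dᵥ-1≤X⁴ : D v - 1ℚ ≤ X * X * X * X
    Dᵥ-1≤X⁴ = ≤-trans (≤-by-gap 1ℚ 0≤1 (restore (D v))) (≤-trans (deg≤n G v) X≤X⁴)

  open Neighbours G

  endpointBound-i : ∀ {v w} → σ v ≡ shrink (D v) → DH v ≡ D v - 1ℚ → (∀ {u} → u ≢ i → u ≢ j → u ≢ w) →
                    D v ÷ fromℕ (dmin G v w) ≤ 1ℚ → EndpointBound v 0ℚ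
  endpointBound-i {v} {w} σv DHv u≢w Dv/dmin≤1 {u} u≢i u≢j Gvu =
    endpoint-≤ σv DHv u≢i u≢j Gvu ≤-refl
      (λ 0<growth → contradiction (<-≤-trans 0<growth (growth-nonPos (0≤fromℕ (deg G v)) Dv≤Du)) (<-irrefl refl))
    where
    -- Without this the hypothesis could hold vacuously, by the junk value x ÷ 0 = 0.
    0<dmin : 0ℚ < fromℕ (dmin G v w)
    0<dmin = fromℕ-mono-< {0} {dmin G v w} (1≤dmin G-sym Gvu (u≢w u≢i u≢j))
    Dv≤Du : D v ≤ D u
    Dv≤Du = ≤-trans (p÷q≤1⇒p≤q 0<dmin Dv/dmin≤1) (fromℕ-mono-≤ (dmin-≤-deg Gvu (u≢w u≢i u≢j)))

  endpointBound-ii : ∀ {v w} → σ v ≡ shrink (D v) → DH v ≡ D v - 1ℚ → (∀ {u} → u ≢ i → u ≢ j → u ≢ w) →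
                     G v w ≡ true → 1ℚ ≤ D v - 1ℚ → D v * D w < (M + ε) * (M + ε) →
                     D v ÷ D w ≤ (D v - ½) ÷ fromℕ (dmax G v w) → D w ÷ D v ≤ (D v - ½) ÷ fromℕ (dmax G v w) →
                     EndpointBound v (lossBudget (D v) (D w) M)
  endpointBound-ii {v} {w} σv DHv u≢w Gvw 1≤Dv-1 DvDw<[M+ε]² Dv/Dw≤ Dw/Dv≤ {u} u≢i u≢j Gvu =
    endpoint-≤ σv DHv u≢i u≢j Gvu (lossBudget-nonNeg {D v} {D w} {M} 1≤Dv-1 (0≤fromℕ (deg G w)) (≤-trans 0≤1 1≤M))
      (λ 0<growth → Loss.termIncrease-≤-lossBudget {D w} {qL v u} {M} {ε} 1≤Dv-1 (0≤fromℕ (deg G w)) (√⁻-nonNeg (deg G v ℕ.* deg G u))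
         L²≤DvDu 1≤M DvDw<[M+ε]² (<⇒≤ 0<ε) (2[D-1]ε≤1 v) c₁ c₂ (<⇒≤ 0<growth))
    where
    module Loss = DegreeLoss (1≤deg G Gvu) (1≤deg G (trans (G-sym u v) Gvu))
    Du≤Dmax : D u ≤ fromℕ (dmax G v w)
    Du≤Dmax = fromℕ-mono-≤ (deg-≤-dmax Gvu (u≢w u≢i u≢j))
    0<Dmax : 0ℚ < fromℕ (dmax G v w)
    0<Dmax = <-≤-trans 0<1 (≤-trans (1≤deg G (trans (G-sym u v) Gvu)) Du≤Dmax)
    0<Dv : 0ℚ < D v
    0<Dv = <-≤-trans 0<1 (1≤deg G Gvu)
    0<Dw : 0ℚ < D w
    0<Dw = <-≤-trans 0<1 (1≤deg G (trans (G-sym w v) Gvw))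
    L²≤DvDu : qL v u * qL v u ≤ D v * D u
    L²≤DvDu = subst (qL v u * qL v u ≤_) (fromℕ-* (deg G v) (deg G u)) (√⁻-square-≤ (deg G v ℕ.* deg G u))
    c₁ : fromℕ 2 * D u * D w ≤ (fromℕ 2 * D v - 1ℚ) * D v
    c₁ = ratio≤⇒2cp≤[2x-1]q {D w} {D v} {D v} {D u} {fromℕ (dmax G v w)} 0<Dv 0<Dmax (0≤fromℕ (deg G w)) Du≤Dmax Dw/Dv≤
    c₂ : fromℕ 2 * D u * D v ≤ (fromℕ 2 * D v - 1ℚ) * D w
    c₂ = ratio≤⇒2cp≤[2x-1]q {D v} {D w} {D v} {D u} {fromℕ (dmax G v w)} 0<Dw 0<Dmax (0≤fromℕ (deg G v)) Du≤Dmax Dv/Dw≤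

  1≤D-1 : ∀ {v w} → G v w ≡ true → deg G v ≢ 1 → 1ℚ ≤ D v - 1ℚ
  1≤D-1 {v} Gvw dᵥ≢1 = ≤-by-gap (D v - fromℕ 2) (p≤q⇒0≤q-p (fromℕ-mono-≤ {2} {deg G v} 2≤dᵥ)) (split (D v))
    where
    2≤dᵥ : 2 ℕ.≤ deg G v
    2≤dᵥ = ℕ.≤∧≢⇒< (fromℕ-cancel-≤ {1} {deg G v} (1≤deg G Gvw)) (dᵥ≢1 ∘ sym)
    split : ∀ d → d - 1ℚ ≡ 1ℚ + (d - fromℕ 2)
    split = solve-∀ ℚ-ring

  GA>-under-condition-i : (D i ÷ fromℕ (dmin G i j)) ⊔ (D j ÷ fromℕ (dmin G j i)) ≤ 1ℚ → GA> G H
  GA>-under-condition-i ratios≤1 = GA>-of-endpointBounds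
    (endpointBound-i σ-i deg-deleteEdge-i (λ _ u≢j → u≢j) (p⊔q≤r⇒p≤r (D i ÷ fromℕ (dmin G i j)) (D j ÷ fromℕ (dmin G j i)) ratios≤1))
    (endpointBound-i σ-j deg-deleteEdge-j (λ u≢i _ → u≢i) (p⊔q≤r⇒q≤r (D i ÷ fromℕ (dmin G i j)) (D j ÷ fromℕ (dmin G j i)) ratios≤1))
    (subst₂ _<_ (sym (no-budgets (D i) (D j) (X * X * ε))) (sym wGᵢⱼ≡) (p*q<r⇒p<r÷q 0<Dᵢ+Dⱼ (begin-strict
      X * X * ε * (D i + D j)                ≤⟨ *-monoˡ-≤ (X * X * ε) (*-nonNeg (*-nonNeg 0≤X 0≤X) (<⇒≤ 0<ε)) Dᵢ+Dⱼ≤2DᵢDⱼ ⟩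
      X * X * ε * (fromℕ 2 * D i * D j)      ≡⟨ *-comm (X * X * ε) (fromℕ 2 * D i * D j) ⟩
      fromℕ 2 * D i * D j * (X * X * ε)      <⟨ 2DᵢDⱼXXε<1 ⟩
      1ℚ                                     ≤⟨ 1≤M ⟩
      M                                      ≤⟨ ≤-by-gap M (≤-trans 0≤1 1≤M) (double M) ⟩
      fromℕ 2 * M                            ∎)))
    where
    open ≤-Reasoning
    0<Dᵢ+Dⱼ = <-≤-trans 0<1 (≤-trans 1≤Dᵢ (≤-by-gap (D j) (0≤fromℕ (deg G j)) refl))
    Dᵢ+Dⱼ≤2DᵢDⱼ : D i + D j ≤ fromℕ 2 * D i * D j
    Dᵢ+Dⱼ≤2DᵢDⱼ = ≤-by-gap ((D i - 1ℚ) * D j + D i * (D j - 1ℚ))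
      (+-nonNeg (*-nonNeg (p≤q⇒0≤q-p 1≤Dᵢ) (0≤fromℕ (deg G j))) (*-nonNeg (0≤fromℕ (deg G i)) (p≤q⇒0≤q-p 1≤Dⱼ)))
      (split (D i) (D j))
      where split : ∀ a b → fromℕ 2 * a * b ≡ a + b + ((a - 1ℚ) * b + a * (b - 1ℚ))
            split = solve-∀ ℚ-ring
    no-budgets : ∀ a b e → (a - 1ℚ) * 0ℚ + (b - 1ℚ) * 0ℚ + e ≡ e
    no-budgets = solve-∀ ℚ-ring
    double : ∀ m → fromℕ 2 * m ≡ m + m
    double = solve-∀ ℚ-ring

  GA>-under-condition-ii : deg G i ≢ 1 → deg G j ≢ 1 →
    (D i ÷ D j) ⊔ (D j ÷ D i) ≤ ((D i - ½) ÷ fromℕ (dmax G i j)) ⊓ ((D j - ½) ÷ fromℕ (dmax G j i)) → GA> G H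
  GA>-under-condition-ii dᵢ≢1 dⱼ≢1 ratios≤ = GA>-of-endpointBounds
    (endpointBound-ii σ-i deg-deleteEdge-i (λ _ u≢j → u≢j) Gij (1≤D-1 Gij dᵢ≢1) DᵢDⱼ<[M+ε]²
      (≤-trans (p≤p⊔q r₁ r₂) (≤-trans ratios≤ (p⊓q≤p bᵢ bⱼ))) (≤-trans (p≤q⊔p r₁ r₂) (≤-trans ratios≤ (p⊓q≤p bᵢ bⱼ))))
    (endpointBound-ii σ-j deg-deleteEdge-j (λ u≢i _ → u≢i) Gji (1≤D-1 Gji dⱼ≢1) (subst (_< (M + ε) * (M + ε)) (*-comm (D i) (D j)) DᵢDⱼ<[M+ε]²)
      (≤-trans (p≤q⊔p r₁ r₂) (≤-trans ratios≤ (p⊓q≤q bᵢ bⱼ))) (≤-trans (p≤p⊔q r₁ r₂) (≤-trans ratios≤ (p⊓q≤q bᵢ bⱼ))))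
    (subst ((D i - 1ℚ) * lossBudget (D i) (D j) M + (D j - 1ℚ) * lossBudget (D j) (D i) M + X * X * ε <_) (sym wGᵢⱼ≡)
      (lossBudgets-< {D i} {D j} {M} {X * X * ε} (1≤D-1 Gij dᵢ≢1) (1≤D-1 Gji dⱼ≢1) (<-≤-trans 2DᵢDⱼXXε<1 1≤M)))
    where
    r₁ = D i ÷ D j
    r₂ = D j ÷ D i
    bᵢ = (D i - ½) ÷ fromℕ (dmax G i j)
    bⱼ = (D j - ½) ÷ fromℕ (dmax G j i)

theorem13 : {n : ℕ} (G : Adj n) → symmetric G → loopless G →
    (i j : Fin n) → G i j ≡ true → deg G i ≢ 1 → deg G j ≢ 1 →
    ((fromℕ (deg G i) ÷ fromℕ (dmin G i j)) ⊔ (fromℕ (deg G j) ÷ fromℕ (dmin G j i)) ≤ 1ℚ)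
    ⊎ ((fromℕ (deg G i) ÷ fromℕ (deg G j)) ⊔ (fromℕ (deg G j) ÷ fromℕ (deg G i))
        ≤ ((fromℕ (deg G i) - ½) ÷ fromℕ (dmax G i j)) ⊓ ((fromℕ (deg G j) - ½) ÷ fromℕ (dmax G j i))) →
    GA> G (deleteEdge G i j)
theorem13 G G-sym G-loopless i j Gij _ _ (inj₁ condition-i) =
  CompareGA.GA>-under-condition-i G G-sym G-loopless i j Gij condition-i
theorem13 G G-sym G-loopless i j Gij dᵢ≢1 dⱼ≢1 (inj₂ condition-ii) =
  CompareGA.GA>-under-condition-ii G G-sym G-loopless i j Gij dᵢ≢1 dⱼ≢1 condition-ii
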